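{- Let $G$ be a connected $\{K_4, K_{2,3},F_1, F_2\}$-induced-minor-free graph. Then $G$ has at most one hole.
   Context: All graphs are finite and simple. A hole is an induced cycle of length at least four. A graph $H$ is an induced minor of $G$ if $H$ can be obtained from $G$ by a sequence of vertex deletions and edge contractions; $G$ is $\mathcal{F}$-induced-minor-free if no member of $\mathcal{F}$ is isomorphic to an induced minor of $G$. $F_1$ is the graph with vertices $u_1,u_2,u_3,w_1,w_2,w_3$ and edges $u_1u_2,u_2u_3,w_1w_2,w_2w_3,u_1w_1,u_2w_2,u_3w_3$. $F_2$ is the graph with vertices $v_1,\dots,v_7$ and edges $v_1v_2,v_2v_3,v_3v_4,v_4v_1,v_4v_5,v_5v_6,v_6v_7,v_7v_4$. -}

module Defs where


open import Data.Nat using (ℕ; zero; suc; _≤_)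
open import Data.Fin using (Fin; toℕ; punchIn)
open import Data.Product using (Σ; _×_; _,_; proj₁; proj₂)
open import Data.Sum using (_⊎_; inj₁; inj₂)
open import Data.List using (List; []; _∷_)
open import Data.List.Membership.Propositional using (_∈_)
open import Function.Bundles using (_↔_; _⇔_; Inverse; Equivalence)
open import Relation.Binary.PropositionalEquality using (_≡_; _≢_; refl; sym)
open import Relation.Binary.Construct.Closure.ReflexiveTransitive using (Star)
open import Relation.Nullary using (¬_)
open import Data.Unit using (⊤)

record Graph (n : ℕ) : Set₁ where
  field
    Adj    : Fin n → Fin n → Set
    adj-sym : ∀ {i j} → Adj i j → Adj j i
    adj-irrefl : ∀ {i} → ¬ Adj i i

open Graph public

fromEdges : {n : ℕ} → (Fin n → Fin n → Set) → Graph n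
fromEdges {n} E = record
  { Adj    = A
  ; adj-sym = λ { (i≢j , inj₁ e) → (λ eq → i≢j (sym eq)) , inj₂ e
               ; (i≢j , inj₂ e) → (λ eq → i≢j (sym eq)) , inj₁ e }
  ; adj-irrefl = λ { (i≢i , _) → i≢i refl }
  }
  where
  A : Fin n → Fin n → Set
  A i j = (i ≢ j) × (E i j ⊎ E j i)

deleteVertex : {n : ℕ} → Graph (suc n) → Fin (suc n) → Graph n
deleteVertex G v = fromEdges λ i j → Adj G (punchIn v i) (punchIn v j)

-- Contract the edge uv (u ≢ v) : v is merged into u.  The remaining
-- vertices are renumbered by punchIn v; the merged vertex is the one
-- mapped to u.
contractEdge : {n : ℕ} → Graph (suc n) → Fin (suc n) → Fin (suc n) → Graph n
contractEdge G u v = fromEdges λ i j →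
  Adj G (punchIn v i) (punchIn v j) ⊎ (punchIn v i ≡ u × Adj G v (punchIn v j))

_≅_ : {m n : ℕ} → Graph m → Graph n → Set
_≅_ {m} {n} H G =
  Σ (Fin m ↔ Fin n) λ f →
    ∀ i j → Adj H i j ⇔ Adj G (Inverse.to f i) (Inverse.to f j)

data _≤im_ {m : ℕ} (H : Graph m) : {n : ℕ} → Graph n → Set₁ where
  iso : ∀ {n} {G : Graph n} → H ≅ G → H ≤im G
  del : ∀ {n} {G : Graph (suc n)} (v : Fin (suc n)) →
        H ≤im deleteVertex G v → H ≤im G
  con : ∀ {n} {G : Graph (suc n)} (u v : Fin (suc n)) → Adj G u v →
        H ≤im contractEdge G u v → H ≤im G

Connected : {n : ℕ} → Graph n → Set
Connected G = ∀ x y → Star (Adj G) x y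

CycleAdj : (k : ℕ) → Fin k → Fin k → Set
CycleAdj k i j =
    toℕ j ≡ suc (toℕ i) ⊎ toℕ i ≡ suc (toℕ j)
  ⊎ (toℕ i ≡ 0 × suc (toℕ j) ≡ k) ⊎ (toℕ j ≡ 0 × suc (toℕ i) ≡ k)

record Hole {n : ℕ} (G : Graph n) : Set where
  field
    len      : ℕ
    len≥4    : 4 ≤ len
    vtx      : Fin len → Fin n
    injective : ∀ i j → vtx i ≡ vtx j → i ≡ j
    induced  : ∀ i j → i ≢ j → (Adj G (vtx i) (vtx j) ⇔ CycleAdj len i j)

open Hole public

-- Holes are considered the same if they have the same vertex set
-- (an induced cycle is determined by its vertex set).
_∈Hole_ : {n : ℕ} {G : Graph n} → Fin n → Hole G → Set
x ∈Hole h = Σ (Fin (len h)) λ i → vtx h i ≡ x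

SameHole : {n : ℕ} {G : Graph n} → Hole G → Hole G → Set
SameHole h₁ h₂ = ∀ x → (x ∈Hole h₁) ⇔ (x ∈Hole h₂)

listGraph : (n : ℕ) → List (ℕ × ℕ) → Graph n
listGraph n es = fromEdges λ i j → (toℕ i , toℕ j) ∈ es

K4 : Graph 4
K4 = fromEdges λ _ _ → ⊤

K23 : Graph 5
K23 = listGraph 5 ((0 , 2) ∷ (0 , 3) ∷ (0 , 4) ∷ (1 , 2) ∷ (1 , 3) ∷ (1 , 4) ∷ [])

-- u₁,u₂,u₃,w₁,w₂,w₃ ↦ 0,1,2,3,4,5
F1 : Graph 6
F1 = listGraph 6 ((0 , 1) ∷ (1 , 2) ∷ (3 , 4) ∷ (4 , 5) ∷ (0 , 3) ∷ (1 , 4) ∷ (2 , 5) ∷ [])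

-- v₁,…,v₇ ↦ 0,…,6
F2 : Graph 7
F2 = listGraph 7 ((0 , 1) ∷ (1 , 2) ∷ (2 , 3) ∷ (3 , 0) ∷ (3 , 4) ∷ (4 , 5) ∷ (5 , 6) ∷ (6 , 3) ∷ [])

-- If S is a connected vertex set disjoint from a hole D, the vertices of D with a neighbour in S are
-- pairwise equal or adjacent: otherwise S and the arcs of D between its attachments contract to K4 or
-- K2,3. Now let x lie on the hole C but not on the hole D. If C meets D, follow C from an edge leaving D;
-- the arc outside D is such a set S, and according to whether C returns to D or S sees a second vertex
-- of D, the two holes contract to F1 or F2. If C and D are disjoint but joined by edges, the clique
-- property confines these edges to one edge of each hole, and the cross edges among its four ends give
-- K4, F1 or F2. Otherwise contracting a path from C to D to a single vertex gives F2.
-- Induced minors are exhibited by disjoint connected branch sets, contracted one edge at a time.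

module Submission where

open import Defs
open import Data.Nat using (ℕ; zero; suc; _+_; _∸_; _≤_; _<_; z≤n; s≤s; _≤?_; _<?_; _<ᵇ_)
open import Data.Nat.Properties
open import Data.Fin using (Fin; zero; suc; toℕ; fromℕ<; punchIn; punchOut; #_)
open import Data.Fin.Properties
  using (toℕ<n; fromℕ<-toℕ; toℕ-fromℕ<; toℕ-injective; any?; all?; punchInᵢ≢i; punchIn-injective; punchIn-punchOut)
  renaming (_≟_ to _≟F_)
open import Data.Maybe using (Maybe; just; nothing)
open import Data.Maybe.Properties using (just-injective)
open import Data.Product using (Σ; _×_; _,_; proj₁; proj₂)
open import Data.Product.Properties using (≡-dec)
open import Data.Sum using (_⊎_; inj₁; inj₂)
open import Data.Empty using (⊥; ⊥-elim)
open import Data.Bool using (if_then_else_)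
open import Data.List using (List; []; _∷_; map; concatMap; allFin)
open import Data.List.Membership.Propositional using (_∈_)
import Data.List.Membership.DecPropositional as DecMembership
open import Data.List.Relation.Unary.Any using (here; there)
open import Data.List.Relation.Unary.All using (All; []; _∷_)
import Data.List.Relation.Unary.All as All
open import Function using (_∘_)
open import Function.Bundles using (Equivalence; mk↔ₛ′; mk⇔)
open import Relation.Binary.PropositionalEquality using (_≡_; _≢_; refl; sym; trans; cong; cong₂; subst; subst₂)
open import Relation.Binary.Construct.Closure.ReflexiveTransitive using (Star; ε; _◅_; _◅◅_)
import Relation.Binary.Construct.Closure.ReflexiveTransitive as Star
open import Relation.Binary.Definitions using (tri<; tri≈; tri>)
open import Relation.Nullary using (¬_; Dec; yes; no)
open import Relation.Nullary.Decidable using (_×-dec_; _⊎-dec_; _→-dec_; ¬?; toWitness; ¬¬-excluded-middle)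

-- Connected sets and models of induced minors

InducedStep : ∀ {n} → Graph n → (Fin n → Set) → Fin n → Fin n → Set
InducedStep G P x y = P x × P y × Adj G x y

record ConnectedSet {n : ℕ} (G : Graph n) : Set₁ where
  field
    Mem      : Fin n → Set
    mem?     : ∀ v → Dec (Mem v)
    root     : Fin n
    mem-root : Mem root
    path     : ∀ v → Mem v → Star (InducedStep G Mem) v root
open ConnectedSet public using (Mem; mem?)

module _ {n : ℕ} {G : Graph n} where

  Touching : ConnectedSet G → ConnectedSet G → Set
  Touching A B = Σ (Fin n) λ x → Σ (Fin n) λ y → Mem A x × Mem B y × Adj G x y

  AttachedTo : ConnectedSet G → Fin n → Set
  AttachedTo S y = Σ (Fin n) λ s → Mem S s × Adj G y s

  singleton : Fin n → ConnectedSet G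
  singleton x = record
    { Mem = _≡ x ; mem? = _≟F x ; root = x ; mem-root = refl ; path = λ { v refl → ε } }

  union : (A B : ConnectedSet G) (x y : Fin n) → Mem A x → Mem B y → x ≡ y ⊎ Adj G x y → ConnectedSet G
  union A B x y x∈A y∈B xy = record
    { Mem = A∪B
    ; mem? = λ v → mem? A v ⊎-dec mem? B v
    ; root = ConnectedSet.root A
    ; mem-root = inj₁ (ConnectedSet.mem-root A)
    ; path = pathA∪B
    }
    where
    A∪B : Fin n → Set
    A∪B v = Mem A v ⊎ Mem B v
    inA : ∀ {u w} → Star (InducedStep G (Mem A)) u w → Star (InducedStep G A∪B) u w
    inA = Star.map λ { (p , q , e) → inj₁ p , inj₁ q , e }
    inB : ∀ {u w} → Star (InducedStep G (Mem B)) u w → Star (InducedStep G A∪B) u w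
    inB = Star.map λ { (p , q , e) → inj₂ p , inj₂ q , e }
    reverseB : ∀ {u w} → Star (InducedStep G (Mem B)) u w → Star (InducedStep G (Mem B)) w u
    reverseB = Star.reverse λ { (p , q , e) → q , p , adj-sym G e }
    y→x : x ≡ y ⊎ Adj G x y → Star (InducedStep G A∪B) y x
    y→x (inj₁ refl) = ε
    y→x (inj₂ e) = (inj₂ y∈B , inj₁ x∈A , adj-sym G e) ◅ ε
    open ConnectedSet using (root; path)
    pathA∪B : ∀ v → A∪B v → Star (InducedStep G A∪B) v (root A)
    pathA∪B v (inj₁ p) = inA (path A v p)
    pathA∪B v (inj₂ p) = inB (path B v p ◅◅ reverseB (path B y y∈B)) ◅◅ (y→x xy ◅◅ inA (path A x x∈A))

  data Walk : Fin n → Fin n → List (Fin n) → Set where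
    [_] : ∀ {c a} → Adj G c a → Walk c a []
    _∷_  : ∀ {c w a ws} → Adj G c w → Walk w a ws → Walk c a (w ∷ ws)

  mutual
    walkSet : ∀ {c a ws} → Walk c a ws → ConnectedSet G
    walkSet {c} {a} [ e ] = union (singleton c) (singleton a) c a refl refl (inj₂ e)
    walkSet {c} (_∷_ {w = w} e walk) = union (singleton c) (walkSet walk) c w refl (walkSet-start walk) (inj₂ e)

    walkSet-start : ∀ {c a ws} (walk : Walk c a ws) → Mem (walkSet walk) c
    walkSet-start [ _ ] = inj₁ refl
    walkSet-start (_ ∷ _) = inj₁ refl

  walkSet-end : ∀ {c a ws} (walk : Walk c a ws) → Mem (walkSet walk) a
  walkSet-end [ _ ] = inj₂ refl
  walkSet-end (_ ∷ walk) = inj₂ (walkSet-end walk)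

  walkSet-inner : ∀ {c a ws v} (walk : Walk c a ws) → v ∈ ws → Mem (walkSet walk) v
  walkSet-inner (_ ∷ walk) (here refl) = inj₂ (walkSet-start walk)
  walkSet-inner (_ ∷ walk) (there v∈) = inj₂ (walkSet-inner walk v∈)

  walkSet-members : ∀ {c a ws v} (walk : Walk c a ws) → Mem (walkSet walk) v → v ≡ c ⊎ v ∈ ws ⊎ v ≡ a
  walkSet-members [ _ ] (inj₁ v≡c) = inj₁ v≡c
  walkSet-members [ _ ] (inj₂ v≡a) = inj₂ (inj₂ v≡a)
  walkSet-members (_ ∷ _) (inj₁ v≡c) = inj₁ v≡c
  walkSet-members (_ ∷ walk) (inj₂ v∈) with walkSet-members walk v∈
  ... | inj₁ v≡w = inj₂ (inj₁ (here v≡w))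
  ... | inj₂ (inj₁ v∈ws) = inj₂ (inj₁ (there v∈ws))
  ... | inj₂ (inj₂ v≡a) = inj₂ (inj₂ v≡a)

  mutual
    walkSetButLast : ∀ {c a ws} → Walk c a ws → ConnectedSet G
    walkSetButLast {c} [ _ ] = singleton c
    walkSetButLast {c} (_∷_ {w = w} e walk) = union (singleton c) (walkSetButLast walk) c w refl (walkSetButLast-start walk) (inj₂ e)

    walkSetButLast-start : ∀ {c a ws} (walk : Walk c a ws) → Mem (walkSetButLast walk) c
    walkSetButLast-start [ _ ] = refl
    walkSetButLast-start (_ ∷ _) = inj₁ refl

  walkSetButLast-members : ∀ {c a ws v} (walk : Walk c a ws) → Mem (walkSetButLast walk) v → v ≡ c ⊎ v ∈ ws
  walkSetButLast-members [ _ ] v≡c = inj₁ v≡c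
  walkSetButLast-members (_ ∷ _) (inj₁ v≡c) = inj₁ v≡c
  walkSetButLast-members (_ ∷ walk) (inj₂ v∈) with walkSetButLast-members walk v∈
  ... | inj₁ v≡w = inj₂ (here v≡w)
  ... | inj₂ v∈ws = inj₂ (there v∈ws)

  walkSetButLast-inner : ∀ {c a ws v} (walk : Walk c a ws) → v ∈ ws → Mem (walkSetButLast walk) v
  walkSetButLast-inner (_ ∷ walk) (here refl) = inj₂ (walkSetButLast-start walk)
  walkSetButLast-inner (_ ∷ walk) (there v∈) = inj₂ (walkSetButLast-inner walk v∈)

  walkSetButLast-last : ∀ {c a ws} (walk : Walk c a ws) → AttachedTo (walkSetButLast walk) a
  walkSetButLast-last {c} [ e ] = c , refl , adj-sym G e
  walkSetButLast-last (_ ∷ walk) with walkSetButLast-last walk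
  ... | z , z∈ , az = z , inj₂ z∈ , az

  DirectWalk : (A B : Fin n → Set) → Set
  DirectWalk A B = Σ (Fin n) λ c → Σ (Fin n) λ a → Σ (List (Fin n)) λ ws →
                   A c × B a × Walk c a ws × All (λ w → ¬ A w × ¬ B w) ws

  module ShortenWalk (A B : Fin n → Set) (A? : ∀ v → Dec (A v)) (B? : ∀ v → Dec (B v))
                     (A∩B : ∀ x → A x → ¬ B x) where

    mutual
      direct : ∀ {x y} → A x → B y → Star (Adj G) x y → DirectWalk A B
      direct x∈A y∈B ε = ⊥-elim (A∩B _ x∈A y∈B)
      direct {x} x∈A y∈B (_◅_ {j = x₁} e rest) with A? x₁ | B? x₁
      ... | yes x₁∈A | _ = direct x₁∈A y∈B rest
      ... | no _ | yes x₁∈B = x , x₁ , [] , x∈A , x₁∈B , [ e ] , []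
      ... | no x₁∉A | no x₁∉B with from-outside x₁∉A x₁∉B rest y∈B
      ...   | inj₁ (a , ws , a∈B , walk , out) = x , a , x₁ ∷ ws , x∈A , a∈B , e ∷ walk , (x₁∉A , x₁∉B) ∷ out
      ...   | inj₂ shortened = shortened

      from-outside : ∀ {x y} → ¬ A x → ¬ B x → Star (Adj G) x y → B y →
                     (Σ (Fin n) λ a → Σ (List (Fin n)) λ ws → B a × Walk x a ws × All (λ w → ¬ A w × ¬ B w) ws) ⊎
                     DirectWalk A B
      from-outside _ x∉B ε y∈B = ⊥-elim (x∉B y∈B)
      from-outside _ _ (_◅_ {j = x₁} e rest) y∈B with A? x₁ | B? x₁
      ... | yes x₁∈A | _ = inj₂ (direct x₁∈A y∈B rest)
      ... | no _ | yes x₁∈B = inj₁ (x₁ , [] , x₁∈B , [ e ] , [])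
      ... | no x₁∉A | no x₁∉B with from-outside x₁∉A x₁∉B rest y∈B
      ...   | inj₁ (a , ws , a∈B , walk , out) = inj₁ (a , x₁ ∷ ws , a∈B , e ∷ walk , (x₁∉A , x₁∉B) ∷ out)
      ...   | inj₂ shortened = inj₂ shortened

-- H ≤im G witnessed by pairwise disjoint connected branch sets, adjacent exactly when
-- the corresponding vertices of H are (vertices of G outside all branch sets are deleted).
record InducedModel {m n : ℕ} (H : Graph m) (G : Graph n) : Set₁ where
  field
    branch   : Fin m → ConnectedSet G
    disjoint : ∀ k l v → Mem (branch k) v → Mem (branch l) v → k ≡ l
    edge     : ∀ i j → Adj H i j → Touching (branch i) (branch j)
    reflect  : ∀ x y i j → Mem (branch i) x → Mem (branch j) y → Adj G x y → i ≢ j → Adj H i j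

-- The same data as a partial labelling of V(G) by V(H); this form is preserved
-- by deleting an unlabelled vertex and by contracting an edge inside a branch set.
record LabelledModel {m n : ℕ} (H : Graph m) (G : Graph n) : Set where
  field
    label      : Fin n → Maybe (Fin m)
    root       : Fin m → Fin n
    label-root : ∀ i → label (root i) ≡ just i
    connected  : ∀ v i → label v ≡ just i → Star (InducedStep G λ w → label w ≡ just i) v (root i)
    edge       : ∀ i j → Adj H i j →
                 Σ (Fin n) λ x → Σ (Fin n) λ y → label x ≡ just i × label y ≡ just j × Adj G x y
    reflect    : ∀ x y i j → label x ≡ just i → label y ≡ just j → Adj G x y → i ≢ j → Adj H i j

module DeleteUnlabelled {m n : ℕ} {H : Graph m} {G : Graph (suc n)} (M : LabelledModel H G)
                        (v : Fin (suc n)) (v-unlabelled : LabelledModel.label M v ≡ nothing) where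
  open LabelledModel M

  label′ : Fin n → Maybe (Fin m)
  label′ x = label (punchIn v x)

  labelled≢v : ∀ {x i} → label x ≡ just i → v ≢ x
  labelled≢v eq refl with trans (sym eq) v-unlabelled
  ... | ()

  root′ : Fin m → Fin n
  root′ i = punchOut (labelled≢v (label-root i))

  adj′ : ∀ a b → Adj G (punchIn v a) (punchIn v b) → Adj (deleteVertex G v) a b
  adj′ a b e = (λ { refl → adj-irrefl G e }) , inj₁ e

  adj-punchOut : ∀ {x y} (px : v ≢ x) (py : v ≢ y) → Adj G x y → Adj (deleteVertex G v) (punchOut px) (punchOut py)
  adj-punchOut px py e = adj′ _ _ (subst₂ (Adj G) (sym (punchIn-punchOut px)) (sym (punchIn-punchOut py)) e)

  path′ : ∀ {i x z} → Star (InducedStep G λ w → label w ≡ just i) x z → ∀ a b →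
          punchIn v a ≡ x → punchIn v b ≡ z → Star (InducedStep (deleteVertex G v) λ w → label′ w ≡ just i) a b
  path′ ε a b refl eb = subst (Star _ a) (punchIn-injective v a b (sym eb)) ε
  path′ {i} (_◅_ {j = y} (lx , ly , e) rest) a b refl eb =
    (lx , subst (λ t → label t ≡ just i) (sym py) ly , adj′ a y′ (subst (Adj G (punchIn v a)) (sym py) e))
    ◅ path′ rest y′ b py eb
    where
    y′ = punchOut (labelled≢v ly)
    py : punchIn v y′ ≡ y
    py = punchIn-punchOut (labelled≢v ly)

  model : LabelledModel H (deleteVertex G v)
  model = record
    { label = label′
    ; root = root′
    ; label-root = λ i → trans (cong label (punchIn-punchOut (labelled≢v (label-root i)))) (label-root i)
    ; connected = λ a i la → path′ (connected (punchIn v a) i la) a (root′ i) refl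
                               (punchIn-punchOut (labelled≢v (label-root i)))
    ; edge = edge′
    ; reflect = λ { x y i j lx ly (_ , inj₁ e) i≢j → reflect _ _ i j lx ly e i≢j
                  ; x y i j lx ly (_ , inj₂ e) i≢j → adj-sym H (reflect _ _ j i ly lx e (i≢j ∘ sym)) }
    }
    where
    edge′ : ∀ i j → Adj H i j → Σ (Fin n) λ x → Σ (Fin n) λ y →
            label′ x ≡ just i × label′ y ≡ just j × Adj (deleteVertex G v) x y
    edge′ i j hij with edge i j hij
    ... | x , y , lx , ly , e =
      punchOut (labelled≢v lx) , punchOut (labelled≢v ly) ,
      trans (cong label (punchIn-punchOut (labelled≢v lx))) lx ,
      trans (cong label (punchIn-punchOut (labelled≢v ly))) ly ,
      adj-punchOut (labelled≢v lx) (labelled≢v ly) e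

module ContractInsideBranch {m n : ℕ} {H : Graph m} {G : Graph (suc n)} (M : LabelledModel H G)
         (u v : Fin (suc n)) (uv : Adj G u v) (same-label : LabelledModel.label M u ≡ LabelledModel.label M v)
         (v-not-root : ∀ j → v ≢ LabelledModel.root M j) where
  open LabelledModel M

  G′ : Graph n
  G′ = contractEdge G u v

  label′ : Fin n → Maybe (Fin m)
  label′ x = label (punchIn v x)

  v≢u : v ≢ u
  v≢u refl = adj-irrefl G uv

  Represents : Fin n → Fin (suc n) → Set
  Represents a x = punchIn v a ≡ x ⊎ (x ≡ v × punchIn v a ≡ u)

  label-represents : ∀ {a x i} → Represents a x → label x ≡ just i → label′ a ≡ just i
  label-represents (inj₁ refl) lx = lx
  label-represents (inj₂ (refl , p)) lx = trans (cong label p) (trans same-label lx)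

  represents-functional : ∀ {a b x} → Represents a x → Represents b x → a ≡ b
  represents-functional (inj₁ p) (inj₁ q) = punchIn-injective v _ _ (trans p (sym q))
  represents-functional (inj₁ p) (inj₂ (refl , _)) = ⊥-elim (punchInᵢ≢i v _ p)
  represents-functional (inj₂ (refl , _)) (inj₁ p) = ⊥-elim (punchInᵢ≢i v _ p)
  represents-functional (inj₂ (_ , p)) (inj₂ (_ , q)) = punchIn-injective v _ _ (trans p (sym q))

  representative : ∀ y → Σ (Fin n) λ b → Represents b y
  representative y with v ≟F y
  ... | yes refl = punchOut v≢u , inj₂ (refl , punchIn-punchOut v≢u)
  ... | no v≢y = punchOut v≢y , inj₁ (punchIn-punchOut v≢y)

  punchIn-≢ : ∀ {a b} → punchIn v a ≢ punchIn v b → a ≢ b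
  punchIn-≢ ne refl = ne refl

  adj-represents : ∀ {a b x y} → Represents a x → Represents b y → Adj G x y → a ≡ b ⊎ Adj G′ a b
  adj-represents (inj₁ refl) (inj₁ refl) e =
    inj₂ (punchIn-≢ (λ q → adj-irrefl G (subst (Adj G _) (sym q) e)) , inj₁ (inj₁ e))
  adj-represents {a} (inj₁ refl) (inj₂ (refl , pb)) e with punchIn v a ≟F u
  ... | yes q = inj₁ (punchIn-injective v _ _ (trans q (sym pb)))
  ... | no q = inj₂ (punchIn-≢ (λ r → q (trans r pb)) , inj₂ (inj₂ (pb , adj-sym G e)))
  adj-represents {b = b} (inj₂ (refl , pa)) (inj₁ refl) e with punchIn v b ≟F u
  ... | yes q = inj₁ (punchIn-injective v _ _ (trans pa (sym q)))
  ... | no q = inj₂ (punchIn-≢ (λ r → q (trans (sym r) pa)) , inj₁ (inj₂ (pa , e)))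
  adj-represents (inj₂ (refl , _)) (inj₂ (refl , _)) e = ⊥-elim (adj-irrefl G e)

  path′ : ∀ {i x z} → Star (InducedStep G λ w → label w ≡ just i) x z → ∀ a b →
          Represents a x → Represents b z → Star (InducedStep G′ λ w → label′ w ≡ just i) a b
  path′ ε a b ra rb = subst (Star _ a) (represents-functional ra rb) ε
  path′ (_◅_ {j = y} (lx , ly , e) rest) a b ra rb with representative y
  ... | c , rc with adj-represents ra rc e
  ...   | inj₁ refl = path′ rest a b rc rb
  ...   | inj₂ e′ = (label-represents ra lx , label-represents rc ly , e′) ◅ path′ rest c b rc rb

  root′ : ∀ j → Σ (Fin n) λ b → Represents b (root j)
  root′ j = punchOut (v-not-root j) , inj₁ (punchIn-punchOut (v-not-root j))

  label-v : ∀ {x i} → punchIn v x ≡ u → label′ x ≡ just i → label v ≡ just i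
  label-v p lx = trans (sym same-label) (trans (sym (cong label p)) lx)

  model : LabelledModel H G′
  model = record
    { label = label′
    ; root = λ j → proj₁ (root′ j)
    ; label-root = λ j → label-represents (proj₂ (root′ j)) (label-root j)
    ; connected = λ a i la → path′ (connected (punchIn v a) i la) a _ (inj₁ refl) (proj₂ (root′ i))
    ; edge = edge′
    ; reflect = reflect′
    }
    where
    edge′ : ∀ i j → Adj H i j → Σ (Fin n) λ x → Σ (Fin n) λ y → label′ x ≡ just i × label′ y ≡ just j × Adj G′ x y
    edge′ i j hij with edge i j hij
    ... | x , y , lx , ly , e with representative x | representative y
    ... | a , ra | b , rb with adj-represents ra rb e
    ...   | inj₂ e′ = a , b , label-represents ra lx , label-represents rb ly , e′
    ...   | inj₁ refl = ⊥-elim (adj-irrefl H (subst (Adj H i)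
                          (just-injective (trans (sym (label-represents rb ly)) (label-represents ra lx))) hij))
    reflect′ : ∀ x y i j → label′ x ≡ just i → label′ y ≡ just j → Adj G′ x y → i ≢ j → Adj H i j
    reflect′ x y i j lx ly (_ , inj₁ (inj₁ e)) i≢j = reflect _ _ i j lx ly e i≢j
    reflect′ x y i j lx ly (_ , inj₁ (inj₂ (p , e))) i≢j = reflect v _ i j (label-v p lx) ly e i≢j
    reflect′ x y i j lx ly (_ , inj₂ (inj₁ e)) i≢j = adj-sym H (reflect _ _ j i ly lx e (i≢j ∘ sym))
    reflect′ x y i j lx ly (_ , inj₂ (inj₂ (p , e))) i≢j =
      adj-sym H (reflect v _ j i (label-v p ly) lx e (i≢j ∘ sym))

module AllRoots {m n : ℕ} {H : Graph m} {G : Graph n} (M : LabelledModel H G)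
                (lab : Fin n → Fin m) (label≡ : ∀ x → LabelledModel.label M x ≡ just (lab x))
                (root-lab : ∀ x → LabelledModel.root M (lab x) ≡ x) where
  open LabelledModel M

  labelled⇒root : ∀ {x i} → label x ≡ just i → x ≡ root i
  labelled⇒root {x} lx = trans (sym (root-lab x)) (cong root (just-injective (trans (sym (label≡ x)) lx)))

  adj→ : ∀ i j → Adj H i j → Adj G (root i) (root j)
  adj→ i j hij with edge i j hij
  ... | x , y , lx , ly , e with labelled⇒root lx | labelled⇒root ly
  ... | refl | refl = e

  H≅G : H ≅ G
  H≅G = mk↔ₛ′ root lab root-lab lab-root , λ i j →
        mk⇔ (adj→ i j) (λ e → reflect _ _ i j (label-root i) (label-root j) e (λ { refl → adj-irrefl G e }))
    where
    lab-root : ∀ i → lab (root i) ≡ i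
    lab-root i = just-injective (trans (sym (label≡ (root i))) (label-root i))

-- Delete an unlabelled vertex, else contract a non-root vertex into its branch, else stop.
labelledModel⇒≤im : ∀ {m n} {H : Graph m} {G : Graph n} → LabelledModel H G → H ≤im G
labelledModel⇒≤im {m} {zero} {H} {G} M =
  iso (mk↔ₛ′ root (λ ()) (λ ()) (λ i → ⊥-elim (no-vertex (root i))) , λ i j → ⊥-elim (no-vertex (root i)))
  where
  open LabelledModel M
  no-vertex : Fin zero → ⊥
  no-vertex ()
labelledModel⇒≤im {m} {suc n} {H} {G} M with any? unlabelled?
  where
  open LabelledModel M
  unlabelled? : ∀ v → Dec (label v ≡ nothing)
  unlabelled? v with label v
  ... | nothing = yes refl
  ... | just _ = no λ ()
... | yes (v , lv) = del v (labelledModel⇒≤im (DeleteUnlabelled.model M v lv))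
... | no all-labelled with any? non-root?
  where
  open LabelledModel M
  NonRoot : Fin (suc n) → Set
  NonRoot v = Σ (Fin m) λ i → label v ≡ just i × v ≢ root i
  non-root? : ∀ v → Dec (NonRoot v)
  non-root? v with label v
  ... | nothing = no λ { (_ , () , _) }
  ... | just i with v ≟F root i
  ...   | yes q = no λ { (_ , refl , ne) → ne q }
  ...   | no ne = yes (i , refl , ne)
... | yes (v , i , lv , v≢root) = contract (connected v i lv)
  where
  open LabelledModel M
  v-not-root : ∀ j → v ≢ root j
  v-not-root j q with just-injective (trans (sym lv) (trans (cong label q) (label-root j)))
  ... | refl = v≢root q
  contract : Star (InducedStep G λ w → label w ≡ just i) v (root i) → H ≤im G
  contract ε = ⊥-elim (v≢root refl)
  contract (_◅_ {j = u} (_ , lu , e) _) =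
    con u v (adj-sym G e)
        (labelledModel⇒≤im (ContractInsideBranch.model M u v (adj-sym G e) (trans lu (sym lv)) v-not-root))
... | no all-roots = iso (AllRoots.H≅G M lab label≡ root-lab)
  where
  open LabelledModel M
  labelled : ∀ x → Σ (Fin m) λ i → label x ≡ just i
  labelled x with label x in eq
  ... | just i = i , refl
  ... | nothing = ⊥-elim (all-labelled (x , eq))
  lab : Fin (suc n) → Fin m
  lab x = proj₁ (labelled x)
  label≡ : ∀ x → label x ≡ just (lab x)
  label≡ x = proj₂ (labelled x)
  root-lab : ∀ x → root (lab x) ≡ x
  root-lab x with root (lab x) ≟F x
  ... | yes q = q
  ... | no q = ⊥-elim (all-roots (x , lab x , label≡ x , q ∘ sym))

module Labelling {m n : ℕ} {H : Graph m} {G : Graph n} (M : InducedModel H G) where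
  open InducedModel M

  label : Fin n → Maybe (Fin m)
  label v with any? (λ k → mem? (branch k) v)
  ... | yes (k , _) = just k
  ... | no _ = nothing

  label⇒mem : ∀ v k → label v ≡ just k → Mem (branch k) v
  label⇒mem v k eq with any? (λ k → mem? (branch k) v)
  label⇒mem v k refl | yes (_ , p) = p
  label⇒mem v k () | no _

  mem⇒label : ∀ v k → Mem (branch k) v → label v ≡ just k
  mem⇒label v k p with any? (λ k → mem? (branch k) v)
  ... | yes (l , q) = cong just (disjoint l k v q p)
  ... | no none = ⊥-elim (none (k , p))

  model : LabelledModel H G
  model = record
    { label = label
    ; root = λ k → ConnectedSet.root (branch k)
    ; label-root = λ k → mem⇒label _ k (ConnectedSet.mem-root (branch k))
    ; connected = λ v k lv → Star.map (λ { (px , py , e) → mem⇒label _ k px , mem⇒label _ k py , e })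
                                      (ConnectedSet.path (branch k) v (label⇒mem v k lv))
    ; edge = λ i j hij → let (x , y , px , py , e) = edge i j hij
                         in x , y , mem⇒label x i px , mem⇒label y j py , e
    ; reflect = λ x y i j lx ly → reflect x y i j (label⇒mem x i lx) (label⇒mem y j ly)
    }

inducedModel⇒≤im : ∀ {m n} {H : Graph m} {G : Graph n} → InducedModel H G → H ≤im G
inducedModel⇒≤im M = labelledModel⇒≤im (Labelling.model M)

-- Building models of the small forbidden graphs

-- The pairs i < j in lexicographic order; the lists of separation proofs below follow this order.
orderedPairs : (m : ℕ) → List (Fin m × Fin m)
orderedPairs m = concatMap (λ i → concatMap (λ j → if toℕ i <ᵇ toℕ j then (i , j) ∷ [] else []) (allFin m)) (allFin m)

module PairLists (m : ℕ) where
  open DecMembership (≡-dec (_≟F_ {m}) (_≟F_ {m})) using () renaming (_∈?_ to _∈F?_)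
  open DecMembership (≡-dec _≟_ _≟_) using () renaming (_∈?_ to _∈ℕ?_)

  Covers : List (Fin m × Fin m) → Set
  Covers ps = ∀ i j → i ≢ j → (i , j) ∈ ps ⊎ (j , i) ∈ ps

  covers? : ∀ ps → Dec (Covers ps)
  covers? ps = all? λ i → all? λ j → ¬? (i ≟F j) →-dec (((i , j) ∈F? ps) ⊎-dec ((j , i) ∈F? ps))

  adj-listGraph? : (es : List (ℕ × ℕ)) → ∀ i j → Dec (Adj (listGraph m es) i j)
  adj-listGraph? es i j = ¬? (i ≟F j) ×-dec (((toℕ i , toℕ j) ∈ℕ? es) ⊎-dec ((toℕ j , toℕ i) ∈ℕ? es))

module FromBranchSets {m n : ℕ} {G : Graph n} (H : Graph m) (adjH? : ∀ i j → Dec (Adj H i j))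
                      (branch : Fin m → ConnectedSet G) where
  open PairLists m

  -- Stated by cases on the decision so that a concrete pair reduces to a concrete condition.
  SeparationFor : {A : Set} → Dec A → Fin n → Fin n → Set
  SeparationFor (yes _) x y = x ≢ y
  SeparationFor (no _) x y = x ≢ y × ¬ Adj G x y

  Separated : Fin m × Fin m → Set
  Separated (i , j) = ∀ x y → Mem (branch i) x → Mem (branch j) y → SeparationFor (adjH? i j) x y

  TouchingPair : Fin m × Fin m → Set
  TouchingPair (i , j) = Touching (branch i) (branch j)

  separated⇒ : ∀ {i j} → Separated (i , j) → ∀ x y → Mem (branch i) x → Mem (branch j) y →
               x ≢ y × (Adj G x y → Adj H i j)
  separated⇒ {i} {j} sep x y px py with adjH? i j | sep x y px py
  ... | yes hij | x≢y = x≢y , λ _ → hij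
  ... | no _ | x≢y , ¬xy = x≢y , λ e → ⊥-elim (¬xy e)

  touching-sym : ∀ {i j} → TouchingPair (i , j) → TouchingPair (j , i)
  touching-sym (x , y , px , py , e) = y , x , py , px , adj-sym G e

  inducedModel : (ps : List (Fin m × Fin m)) → Covers ps → All Separated ps →
                 (∀ i j → Adj H i j → TouchingPair (i , j)) → InducedModel H G
  inducedModel ps cover seps edge = record
    { branch = branch
    ; disjoint = disjoint
    ; edge = edge
    ; reflect = reflect
    }
    where
    disjoint : ∀ k l v → Mem (branch k) v → Mem (branch l) v → k ≡ l
    disjoint k l v pk pl with k ≟F l
    ... | yes k≡l = k≡l
    ... | no k≢l with cover k l k≢l
    ...   | inj₁ kl = ⊥-elim (proj₁ (separated⇒ (All.lookup seps kl) v v pk pl) refl)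
    ...   | inj₂ lk = ⊥-elim (proj₁ (separated⇒ (All.lookup seps lk) v v pl pk) refl)
    reflect : ∀ x y i j → Mem (branch i) x → Mem (branch j) y → Adj G x y → i ≢ j → Adj H i j
    reflect x y i j px py e i≢j with cover i j i≢j
    ... | inj₁ ij = proj₂ (separated⇒ (All.lookup seps ij) x y px py) e
    ... | inj₂ ji = adj-sym H (proj₂ (separated⇒ (All.lookup seps ji) y x py px) (adj-sym G e))

  toℕ-pairs : List (Fin m × Fin m) → List (ℕ × ℕ)
  toℕ-pairs = map λ (i , j) → toℕ i , toℕ j

  touching-lookup : ∀ {i j} fs → All TouchingPair fs → (toℕ i , toℕ j) ∈ toℕ-pairs fs → TouchingPair (i , j)
  touching-lookup (_ ∷ _) (t ∷ _) (here eq) with toℕ-injective (cong proj₁ eq) | toℕ-injective (cong proj₂ eq)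
  ... | refl | refl = t
  touching-lookup (_ ∷ fs) (_ ∷ ts) (there mem) = touching-lookup fs ts mem

  listGraph-edges : (es : List (ℕ × ℕ)) (fs : List (Fin m × Fin m)) → es ≡ toℕ-pairs fs →
                    All TouchingPair fs → ∀ i j → Adj (listGraph m es) i j → TouchingPair (i , j)
  listGraph-edges es fs refl touch i j (_ , inj₁ ij) = touching-lookup fs touch ij
  listGraph-edges es fs refl touch i j (_ , inj₂ ji) = touching-sym (touching-lookup fs touch ji)

module ListGraphModel {m n : ℕ} {G : Graph n} (es : List (ℕ × ℕ)) (branch : Fin m → ConnectedSet G) where
  open PairLists m public
  open FromBranchSets (listGraph m es) (adj-listGraph? es) branch public

  listGraph≤im : Covers (orderedPairs m) → All Separated (orderedPairs m) →
                 (fs : List (Fin m × Fin m)) → es ≡ toℕ-pairs fs → All TouchingPair fs → listGraph m es ≤im G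
  listGraph≤im covers seps fs es≡ touch =
    inducedModel⇒≤im (inducedModel (orderedPairs m) covers seps (listGraph-edges es fs es≡ touch))

adj-K4? : ∀ i j → Dec (Adj K4 i j)
adj-K4? i j with i ≟F j
... | yes i≡j = no λ { (i≢j , _) → i≢j i≡j }
... | no i≢j = yes (i≢j , inj₁ _)

module K4Model {n : ℕ} {G : Graph n} (branch : Fin 4 → ConnectedSet G) where
  open PairLists 4
  open FromBranchSets K4 adj-K4? branch public

  K4≤im : All Separated (orderedPairs 4) → All TouchingPair (orderedPairs 4) → K4 ≤im G
  K4≤im seps touch = inducedModel⇒≤im (inducedModel (orderedPairs 4) covers seps edges)
    where
    covers : Covers (orderedPairs 4)
    covers = toWitness {a? = covers? (orderedPairs 4)} _
    edges : ∀ i j → Adj K4 i j → TouchingPair (i , j)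
    edges i j (i≢j , _) with covers i j i≢j
    ... | inj₁ ij = All.lookup touch ij
    ... | inj₂ ji = touching-sym (All.lookup touch ji)

module K23Model {n : ℕ} {G : Graph n} (branch : Fin 5 → ConnectedSet G) where
  open ListGraphModel ((0 , 2) ∷ (0 , 3) ∷ (0 , 4) ∷ (1 , 2) ∷ (1 , 3) ∷ (1 , 4) ∷ []) branch public

  K23-edges : List (Fin 5 × Fin 5)
  K23-edges = (# 0 , # 2) ∷ (# 0 , # 3) ∷ (# 0 , # 4) ∷ (# 1 , # 2) ∷ (# 1 , # 3) ∷ (# 1 , # 4) ∷ []

  K23≤im : All Separated (orderedPairs 5) → All TouchingPair K23-edges → K23 ≤im G
  K23≤im seps = listGraph≤im (toWitness {a? = covers? (orderedPairs 5)} _) seps K23-edges refl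

module F1Model {n : ℕ} {G : Graph n} (branch : Fin 6 → ConnectedSet G) where
  open ListGraphModel ((0 , 1) ∷ (1 , 2) ∷ (3 , 4) ∷ (4 , 5) ∷ (0 , 3) ∷ (1 , 4) ∷ (2 , 5) ∷ []) branch public

  F1-edges : List (Fin 6 × Fin 6)
  F1-edges = (# 0 , # 1) ∷ (# 1 , # 2) ∷ (# 3 , # 4) ∷ (# 4 , # 5) ∷ (# 0 , # 3) ∷ (# 1 , # 4) ∷ (# 2 , # 5) ∷ []

  F1≤im : All Separated (orderedPairs 6) → All TouchingPair F1-edges → F1 ≤im G
  F1≤im seps = listGraph≤im (toWitness {a? = covers? (orderedPairs 6)} _) seps F1-edges refl

module F2Model {n : ℕ} {G : Graph n} (branch : Fin 7 → ConnectedSet G) where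
  open ListGraphModel ((0 , 1) ∷ (1 , 2) ∷ (2 , 3) ∷ (3 , 0) ∷ (3 , 4) ∷ (4 , 5) ∷ (5 , 6) ∷ (6 , 3) ∷ []) branch public

  F2-edges : List (Fin 7 × Fin 7)
  F2-edges = (# 0 , # 1) ∷ (# 1 , # 2) ∷ (# 2 , # 3) ∷ (# 3 , # 0) ∷ (# 3 , # 4) ∷ (# 4 , # 5) ∷ (# 5 , # 6) ∷ (# 6 , # 3) ∷ []

  F2≤im : All Separated (orderedPairs 7) → All TouchingPair F2-edges → F2 ≤im G
  F2≤im seps = listGraph≤im (toWitness {a? = covers? (orderedPairs 7)} _) seps F2-edges refl

-- Arithmetic of cycle positions

CycleAdjℕ : ℕ → ℕ → ℕ → Set
CycleAdjℕ k a b = b ≡ suc a ⊎ a ≡ suc b ⊎ (a ≡ 0 × suc b ≡ k) ⊎ (b ≡ 0 × suc a ≡ k)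

cycleAdj-sym : ∀ {k a b} → CycleAdjℕ k a b → CycleAdjℕ k b a
cycleAdj-sym (inj₁ p) = inj₂ (inj₁ p)
cycleAdj-sym (inj₂ (inj₁ p)) = inj₁ p
cycleAdj-sym (inj₂ (inj₂ (inj₁ p))) = inj₂ (inj₂ (inj₂ p))
cycleAdj-sym (inj₂ (inj₂ (inj₂ p))) = inj₂ (inj₂ (inj₁ p))

cycleAdj-irrefl : ∀ {k a} → 1 < k → ¬ CycleAdjℕ k a a
cycleAdj-irrefl _ (inj₁ p) = 1+n≢n (sym p)
cycleAdj-irrefl _ (inj₂ (inj₁ p)) = 1+n≢n (sym p)
cycleAdj-irrefl 1<k (inj₂ (inj₂ (inj₁ (refl , refl)))) = <-irrefl refl 1<k
cycleAdj-irrefl 1<k (inj₂ (inj₂ (inj₂ (refl , refl)))) = <-irrefl refl 1<k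

cycleAdj-gap : ∀ {k a b} → suc (suc a) ≤ b → (0 < a ⊎ suc b < k) → ¬ CycleAdjℕ k a b
cycleAdj-gap a+2≤b _ (inj₁ refl) = <-irrefl refl a+2≤b
cycleAdj-gap {b = b} a+2≤b _ (inj₂ (inj₁ refl)) = <-irrefl refl (≤-trans (m≤n+m (suc b) 2) a+2≤b)
cycleAdj-gap _ (inj₁ ()) (inj₂ (inj₂ (inj₁ (refl , _))))
cycleAdj-gap _ (inj₂ b+1<k) (inj₂ (inj₂ (inj₁ (refl , refl)))) = <-irrefl refl b+1<k
cycleAdj-gap () _ (inj₂ (inj₂ (inj₂ (refl , _))))

SucMod : ℕ → ℕ → ℕ → Set
SucMod L a a′ = (suc a ≡ L × a′ ≡ 0) ⊎ (suc a < L × a′ ≡ suc a)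

private
  wrap-reflects : ∀ {L a b} → suc a ≡ L → suc b < L → CycleAdjℕ L 0 (suc b) → CycleAdjℕ L a b
  wrap-reflects a+1≡L _ (inj₁ refl) = inj₂ (inj₂ (inj₂ (refl , a+1≡L)))
  wrap-reflects a+1≡L _ (inj₂ (inj₂ (inj₁ (_ , b+2≡L)))) = inj₂ (inj₁ (suc-injective (trans a+1≡L (sym b+2≡L))))

  wrap-preserves : ∀ {L a b} → suc a ≡ L → suc b < L → CycleAdjℕ L a b → CycleAdjℕ L 0 (suc b)
  wrap-preserves {a = a} refl b+1<L (inj₁ refl) = ⊥-elim (<-irrefl refl (≤-trans (n≤1+n (suc (suc a))) b+1<L))
  wrap-preserves a+1≡L _ (inj₂ (inj₁ refl)) = inj₂ (inj₂ (inj₁ (refl , a+1≡L)))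
  wrap-preserves _ b+1<L (inj₂ (inj₂ (inj₁ (_ , refl)))) = ⊥-elim (<-irrefl refl b+1<L)
  wrap-preserves _ _ (inj₂ (inj₂ (inj₂ (refl , _)))) = inj₁ refl

sucMod-reflects-adj : ∀ {L a b a′ b′} → 1 < L → SucMod L a a′ → SucMod L b b′ → CycleAdjℕ L a′ b′ → CycleAdjℕ L a b
sucMod-reflects-adj 1<L (inj₁ (_ , refl)) (inj₁ (_ , refl)) c = ⊥-elim (cycleAdj-irrefl 1<L c)
sucMod-reflects-adj _ (inj₁ (pa , refl)) (inj₂ (pb , refl)) c = wrap-reflects pa pb c
sucMod-reflects-adj _ (inj₂ (pa , refl)) (inj₁ (pb , refl)) c = cycleAdj-sym (wrap-reflects pb pa (cycleAdj-sym c))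
sucMod-reflects-adj _ (inj₂ (_ , refl)) (inj₂ (_ , refl)) (inj₁ p) = inj₁ (suc-injective p)
sucMod-reflects-adj _ (inj₂ (_ , refl)) (inj₂ (_ , refl)) (inj₂ (inj₁ p)) = inj₂ (inj₁ (suc-injective p))
sucMod-reflects-adj _ (inj₂ (_ , refl)) (inj₂ (_ , refl)) (inj₂ (inj₂ (inj₁ (() , _))))
sucMod-reflects-adj _ (inj₂ (_ , refl)) (inj₂ (_ , refl)) (inj₂ (inj₂ (inj₂ (() , _))))

sucMod-preserves-adj : ∀ {L a b a′ b′} → 1 < L → SucMod L a a′ → SucMod L b b′ → CycleAdjℕ L a b → CycleAdjℕ L a′ b′
sucMod-preserves-adj 1<L (inj₁ (pa , refl)) (inj₁ (pb , refl)) c with suc-injective (trans pa (sym pb))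
... | refl = ⊥-elim (cycleAdj-irrefl 1<L c)
sucMod-preserves-adj _ (inj₁ (pa , refl)) (inj₂ (pb , refl)) c = wrap-preserves pa pb c
sucMod-preserves-adj _ (inj₂ (pa , refl)) (inj₁ (pb , refl)) c = cycleAdj-sym (wrap-preserves pb pa (cycleAdj-sym c))
sucMod-preserves-adj _ (inj₂ (_ , refl)) (inj₂ (_ , refl)) (inj₁ p) = inj₁ (cong suc p)
sucMod-preserves-adj _ (inj₂ (_ , refl)) (inj₂ (_ , refl)) (inj₂ (inj₁ p)) = inj₂ (inj₁ (cong suc p))
sucMod-preserves-adj _ (inj₂ (_ , refl)) (inj₂ (pb , refl)) (inj₂ (inj₂ (inj₁ (_ , q)))) = ⊥-elim (<-irrefl q pb)
sucMod-preserves-adj _ (inj₂ (pa , refl)) (inj₂ (_ , refl)) (inj₂ (inj₂ (inj₂ (_ , q)))) = ⊥-elim (<-irrefl q pa)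

SucMod-injective : ∀ {L a b c} → SucMod L a c → SucMod L b c → a ≡ b
SucMod-injective (inj₁ (pa , _)) (inj₁ (pb , _)) = suc-injective (trans pa (sym pb))
SucMod-injective (inj₁ (_ , refl)) (inj₂ (_ , ()))
SucMod-injective (inj₂ (_ , refl)) (inj₁ (_ , ()))
SucMod-injective (inj₂ (_ , refl)) (inj₂ (_ , q)) = suc-injective q

SucMod-functional : ∀ {L a x y} → SucMod L a x → SucMod L a y → x ≡ y
SucMod-functional (inj₁ (_ , refl)) (inj₁ (_ , refl)) = refl
SucMod-functional (inj₁ (p , _)) (inj₂ (q , _)) = ⊥-elim (<-irrefl p q)
SucMod-functional (inj₂ (q , _)) (inj₁ (p , _)) = ⊥-elim (<-irrefl p q)
SucMod-functional (inj₂ (_ , refl)) (inj₂ (_ , refl)) = refl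

NegMod : ℕ → ℕ → ℕ → Set
NegMod L a a′ = a < L × ((a ≡ 0 × a′ ≡ 0) ⊎ (0 < a × a′ + a ≡ L))

private
  neg-reflects : ∀ {L b b′} → b′ + b ≡ L → 0 < b → b < L → CycleAdjℕ L 0 b′ → CycleAdjℕ L 0 b
  neg-reflects e _ _ (inj₁ refl) = inj₂ (inj₂ (inj₁ (refl , e)))
  neg-reflects {b = b} {b′} e _ _ (inj₂ (inj₂ (inj₁ (_ , q)))) =
    inj₁ (+-cancelˡ-≡ b′ b 1 (trans e (trans (sym q) (+-comm 1 b′))))
  neg-reflects e _ b<L (inj₂ (inj₂ (inj₂ (refl , _)))) = ⊥-elim (<-irrefl e b<L)

NegMod-reflects-adj : ∀ {L a b a′ b′} → NegMod L a a′ → NegMod L b b′ → CycleAdjℕ L a′ b′ → CycleAdjℕ L a b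
NegMod-reflects-adj (_ , inj₁ (refl , refl)) (_ , inj₁ (refl , refl)) c = c
NegMod-reflects-adj (_ , inj₁ (refl , refl)) (b<L , inj₂ (0<b , e)) c = neg-reflects e 0<b b<L c
NegMod-reflects-adj (a<L , inj₂ (0<a , e)) (_ , inj₁ (refl , refl)) c = cycleAdj-sym (neg-reflects e 0<a a<L (cycleAdj-sym c))
NegMod-reflects-adj {a = a} {b} {a′} (_ , inj₂ (_ , ea)) (_ , inj₂ (_ , eb)) (inj₁ refl) =
  inj₂ (inj₁ (+-cancelˡ-≡ a′ a (suc b) (trans ea (trans (sym eb) (sym (+-suc a′ b))))))
NegMod-reflects-adj {a = a} {b} {b′ = b′} (_ , inj₂ (_ , ea)) (_ , inj₂ (_ , eb)) (inj₂ (inj₁ refl)) =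
  inj₁ (+-cancelˡ-≡ b′ b (suc a) (trans eb (trans (sym ea) (sym (+-suc b′ a)))))
NegMod-reflects-adj (a<L , inj₂ (_ , ea)) _ (inj₂ (inj₂ (inj₁ (refl , _)))) = ⊥-elim (<-irrefl ea a<L)
NegMod-reflects-adj _ (b<L , inj₂ (_ , eb)) (inj₂ (inj₂ (inj₂ (refl , _)))) = ⊥-elim (<-irrefl eb b<L)

NegMod-sym : ∀ {L a a′} → NegMod L a a′ → NegMod L a′ a
NegMod-sym (a<L , inj₁ (refl , refl)) = a<L , inj₁ (refl , refl)
NegMod-sym {L} {suc a} {a′} (a<L , inj₂ (_ , e)) = a′<L , inj₂ (0<a′ a′ e a<L , trans (+-comm (suc a) a′) e)
  where
  a′<L : a′ < L
  a′<L = subst (a′ <_) e (subst (_≤ a′ + suc a) (+-comm a′ 1) (+-monoʳ-≤ a′ (s≤s z≤n)))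
  0<a′ : ∀ a′ → a′ + suc a ≡ L → suc a < L → 0 < a′
  0<a′ zero refl a<L = ⊥-elim (<-irrefl refl a<L)
  0<a′ (suc _) _ _ = s≤s z≤n

NegMod-preserves-adj : ∀ {L a b a′ b′} → NegMod L a a′ → NegMod L b b′ → CycleAdjℕ L a b → CycleAdjℕ L a′ b′
NegMod-preserves-adj na nb = NegMod-reflects-adj (NegMod-sym na) (NegMod-sym nb)

NegMod-injective : ∀ {L a b c} → NegMod L a c → NegMod L b c → a ≡ b
NegMod-injective (_ , inj₁ (refl , _)) (_ , inj₁ (refl , _)) = refl
NegMod-injective (_ , inj₁ (refl , refl)) (b<L , inj₂ (_ , e)) = ⊥-elim (<-irrefl e b<L)
NegMod-injective (a<L , inj₂ (_ , e)) (_ , inj₁ (refl , refl)) = ⊥-elim (<-irrefl e a<L)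
NegMod-injective {c = c} (_ , inj₂ (_ , e)) (_ , inj₂ (_ , e′)) = +-cancelˡ-≡ c _ _ (trans e (sym e′))

NegMod-functional : ∀ {L a x y} → NegMod L a x → NegMod L a y → x ≡ y
NegMod-functional (_ , inj₁ (_ , refl)) (_ , inj₁ (_ , refl)) = refl
NegMod-functional (_ , inj₁ (refl , _)) (_ , inj₂ (() , _))
NegMod-functional (_ , inj₂ (() , _)) (_ , inj₁ (refl , _))
NegMod-functional {a = a} (_ , inj₂ (_ , e)) (_ , inj₂ (_ , e′)) = +-cancelʳ-≡ a _ _ (trans e (sym e′))

sucMod : ∀ {L} → Fin L → Fin L
sucMod {suc L} i with suc (toℕ i) <? suc L
... | yes p = fromℕ< p
... | no _ = zero

sucMod-spec : ∀ {L} (i : Fin L) → SucMod L (toℕ i) (toℕ (sucMod i))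
sucMod-spec {suc L} i with suc (toℕ i) <? suc L
... | yes p = inj₂ (p , toℕ-fromℕ< p)
... | no np = inj₁ (≤-antisym (toℕ<n i) (≮⇒≥ np) , refl)

negMod : ∀ {L} → Fin L → Fin L
negMod {suc L} zero = zero
negMod {suc L} (suc k) = fromℕ< {L ∸ toℕ k} (s≤s (m∸n≤m L (toℕ k)))

negMod-spec : ∀ {L} (i : Fin L) → NegMod L (toℕ i) (toℕ (negMod i))
negMod-spec {suc L} zero = s≤s z≤n , inj₁ (refl , refl)
negMod-spec {suc L} (suc k) = toℕ<n (suc k) , inj₂ (s≤s z≤n ,
  trans (cong (_+ suc (toℕ k)) (toℕ-fromℕ< {L ∸ toℕ k} (s≤s (m∸n≤m L (toℕ k)))))
        (trans (+-suc (L ∸ toℕ k) (toℕ k)) (cong suc (m∸n+n≡m (<⇒≤ (toℕ<n k))))))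

least-witness : (Q : ℕ → Set) → (∀ k → Dec (Q k)) → ∀ m → Q m → Σ ℕ λ k → Q k × (∀ j → j < k → ¬ Q j)
least-witness Q Q? m Qm = search 0 (λ _ ()) m (subst Q (sym (+-identityʳ m)) Qm)
  where
  search : ∀ b → (∀ j → j < b → ¬ Q j) → ∀ m → Q (m + b) → Σ ℕ λ k → Q k × (∀ j → j < k → ¬ Q j)
  search b below m Qm+b with Q? b
  ... | yes Qb = b , Qb , below
  search b below zero Qb | no ¬Qb = ⊥-elim (¬Qb Qb)
  search b below (suc m) Qm+b | no ¬Qb = search (suc b) below′ m (subst Q (sym (+-suc m b)) Qm+b)
    where
    below′ : ∀ j → j < suc b → ¬ Q j
    below′ j j<b+1 with m≤n⇒m<n∨m≡n (≤-pred j<b+1)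
    ... | inj₁ j<b = below j j<b
    ... | inj₂ refl = ¬Qb

-- Holes

index≢0 : ∀ {lo i} → 1 ≤ lo → lo ≤ i → i ≢ 0
index≢0 1≤lo lo≤i refl with ≤-trans 1≤lo lo≤i
... | ()

private
  module FourOrMore {L : ℕ} where
    0<L : 4 ≤ L → 0 < L
    0<L (s≤s _) = s≤s z≤n
    L∸1<L : 4 ≤ L → L ∸ 1 < L
    L∸1<L (s≤s (s≤s (s≤s (s≤s _)))) = ≤-refl
    suc[L∸1]≡L : 4 ≤ L → suc (L ∸ 1) ≡ L
    suc[L∸1]≡L (s≤s (s≤s (s≤s (s≤s _)))) = refl
    2<L∸1 : 4 ≤ L → 2 < L ∸ 1
    2<L∸1 (s≤s (s≤s (s≤s (s≤s _)))) = s≤s (s≤s (s≤s z≤n))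
    2≤L∸2 : 4 ≤ L → 2 ≤ L ∸ 2
    2≤L∸2 (s≤s (s≤s (s≤s (s≤s _)))) = s≤s (s≤s z≤n)
    L∸2<L∸1 : 4 ≤ L → L ∸ 2 < L ∸ 1
    L∸2<L∸1 (s≤s (s≤s (s≤s (s≤s _)))) = ≤-refl
    suc[L∸2]≡L∸1 : 4 ≤ L → suc (L ∸ 2) ≡ L ∸ 1
    suc[L∸2]≡L∸1 (s≤s (s≤s (s≤s (s≤s _)))) = refl

module _ {n : ℕ} {G : Graph n} where

  0<len : (h : Hole G) → 0 < len h
  0<len h = FourOrMore.0<L (len≥4 h)

  1<len : (h : Hole G) → 1 < len h
  1<len h = ≤-trans (s≤s (s≤s z≤n)) (len≥4 h)

  2<len : (h : Hole G) → 2 < len h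
  2<len h = ≤-trans (s≤s (s≤s (s≤s z≤n))) (len≥4 h)

  len∸1<len : (h : Hole G) → len h ∸ 1 < len h
  len∸1<len h = FourOrMore.L∸1<L (len≥4 h)

  suc[len∸1]≡len : (h : Hole G) → suc (len h ∸ 1) ≡ len h
  suc[len∸1]≡len h = FourOrMore.suc[L∸1]≡L (len≥4 h)

  2<len∸1 : (h : Hole G) → 2 < len h ∸ 1
  2<len∸1 h = FourOrMore.2<L∸1 (len≥4 h)

  1≤len∸1 : (h : Hole G) → 1 ≤ len h ∸ 1
  1≤len∸1 h = ≤-trans (s≤s z≤n) (2<len∸1 h)

  2≤len∸2 : (h : Hole G) → 2 ≤ len h ∸ 2
  2≤len∸2 h = FourOrMore.2≤L∸2 (len≥4 h)

  len∸2<len∸1 : (h : Hole G) → len h ∸ 2 < len h ∸ 1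
  len∸2<len∸1 h = FourOrMore.L∸2<L∸1 (len≥4 h)

  len∸2<len : (h : Hole G) → len h ∸ 2 < len h
  len∸2<len h = <-trans (len∸2<len∸1 h) (len∸1<len h)

  suc[len∸2]≡len∸1 : (h : Hole G) → suc (len h ∸ 2) ≡ len h ∸ 1
  suc[len∸2]≡len∸1 h = FourOrMore.suc[L∸2]≡L∸1 (len≥4 h)

  adj⇒cycleAdj : (h : Hole G) → ∀ i j → Adj G (vtx h i) (vtx h j) → CycleAdjℕ (len h) (toℕ i) (toℕ j)
  adj⇒cycleAdj h i j e with i ≟F j
  ... | yes refl = ⊥-elim (adj-irrefl G e)
  ... | no i≢j = Equivalence.to (induced h i j i≢j) e

  cycleAdj⇒adj : (h : Hole G) → ∀ i j → CycleAdjℕ (len h) (toℕ i) (toℕ j) → Adj G (vtx h i) (vtx h j)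
  cycleAdj⇒adj h i j c with i ≟F j
  ... | yes refl = ⊥-elim (cycleAdj-irrefl (1<len h) c)
  ... | no i≢j = Equivalence.from (induced h i j i≢j) c

  _∈Hole?_ : ∀ x (h : Hole G) → Dec (x ∈Hole h)
  x ∈Hole? h = any? λ i → vtx h i ≟F x

  SameHole-refl : (h : Hole G) → SameHole h h
  SameHole-refl h x = mk⇔ (λ m → m) (λ m → m)

  SameHole-trans : {h₁ h₂ h₃ : Hole G} → SameHole h₁ h₂ → SameHole h₂ h₃ → SameHole h₁ h₃
  SameHole-trans s t x = mk⇔ (Equivalence.to (t x) ∘ Equivalence.to (s x))
                             (Equivalence.from (s x) ∘ Equivalence.from (t x))

  module Reindex (h : Hole G) (f : Fin (len h) → Fin (len h))
                 (f-injective : ∀ i j → f i ≡ f j → i ≡ j)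
                 (f-reflects : ∀ i j → CycleAdjℕ (len h) (toℕ (f i)) (toℕ (f j)) → CycleAdjℕ (len h) (toℕ i) (toℕ j))
                 (f-preserves : ∀ i j → CycleAdjℕ (len h) (toℕ i) (toℕ j) → CycleAdjℕ (len h) (toℕ (f i)) (toℕ (f j)))
                 (f-surjective : ∀ j → Σ (Fin (len h)) λ i → f i ≡ j) where

    hole : Hole G
    hole = record
      { len = len h
      ; len≥4 = len≥4 h
      ; vtx = vtx h ∘ f
      ; injective = λ i j eq → f-injective i j (injective h _ _ eq)
      ; induced = λ i j i≢j →
          mk⇔ (λ e → f-reflects i j (Equivalence.to (induced h (f i) (f j) (i≢j ∘ f-injective i j)) e))
              (λ c → Equivalence.from (induced h (f i) (f j) (i≢j ∘ f-injective i j)) (f-preserves i j c))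
      }

    same : SameHole h hole
    same x = mk⇔ (λ { (j , eq) → let (i , fi≡j) = f-surjective j in i , trans (cong (vtx h) fi≡j) eq })
                 (λ { (i , eq) → f i , eq })

  at : (h : Hole G) (k : ℕ) → k < len h → Fin n
  at h k k<len = vtx h (fromℕ< k<len)

  at-toℕ : (h : Hole G) (i : Fin (len h)) → vtx h i ≡ at h (toℕ i) (toℕ<n i)
  at-toℕ h i = cong (vtx h) (sym (fromℕ<-toℕ i (toℕ<n i)))

  vtx≡at : (h : Hole G) (i : Fin (len h)) {k : ℕ} (k<len : k < len h) → toℕ i ≡ k → vtx h i ≡ at h k k<len
  vtx≡at h i _ refl = at-toℕ h i

  v0 v1 vlast : Hole G → Fin n
  v0 h = at h 0 (0<len h)
  v1 h = at h 1 (1<len h)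
  vlast h = at h (len h ∸ 1) (len∸1<len h)

  v0∈ : (h : Hole G) → v0 h ∈Hole h
  v0∈ h = _ , refl

  v1∈ : (h : Hole G) → v1 h ∈Hole h
  v1∈ h = _ , refl

  adjAt : (h : Hole G) {k l : ℕ} (k<len : k < len h) (l<len : l < len h) → CycleAdjℕ (len h) k l →
          Adj G (at h k k<len) (at h l l<len)
  adjAt h k<len l<len c =
    cycleAdj⇒adj h _ _ (subst₂ (CycleAdjℕ (len h)) (sym (toℕ-fromℕ< k<len)) (sym (toℕ-fromℕ< l<len)) c)

  adj-suc : (h : Hole G) (k : ℕ) (k+1<len : suc k < len h) → Adj G (at h k (<-trans (n<1+n k) k+1<len)) (at h (suc k) k+1<len)
  adj-suc h k k+1<len = adjAt h (<-trans (n<1+n k) k+1<len) k+1<len (inj₁ refl)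

  adj-v0-v1 : (h : Hole G) → Adj G (v0 h) (v1 h)
  adj-v0-v1 h = adjAt h (0<len h) (1<len h) (inj₁ refl)

  adj-vlast-v0 : (h : Hole G) → Adj G (vlast h) (v0 h)
  adj-vlast-v0 h = adjAt h (len∸1<len h) (0<len h) (inj₂ (inj₂ (inj₂ (refl , suc[len∸1]≡len h))))

  index-v0 : (h : Hole G) (i : Fin (len h)) → vtx h i ≡ v0 h → toℕ i ≡ 0
  index-v0 h i eq = trans (cong toℕ (injective h i _ eq)) (toℕ-fromℕ< (0<len h))

  index-vlast : (h : Hole G) (i : Fin (len h)) → vtx h i ≡ vlast h → suc (toℕ i) ≡ len h
  index-vlast h i eq = trans (cong (suc ∘ toℕ) (injective h i _ eq))
                             (trans (cong suc (toℕ-fromℕ< (len∸1<len h))) (suc[len∸1]≡len h))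

  private
    sucMod-surjective : (h : Hole G) → ∀ j → Σ (Fin (len h)) λ i → sucMod i ≡ j
    sucMod-surjective h j with toℕ j in eq
    ... | zero = fromℕ< (len∸1<len h) , toℕ-injective (trans
                   (SucMod-functional (sucMod-spec _) (inj₁ (trans (cong suc (toℕ-fromℕ< _)) (suc[len∸1]≡len h) , refl)))
                   (sym eq))
    ... | suc k = fromℕ< k<len , toℕ-injective (trans
                    (SucMod-functional (sucMod-spec _) (inj₂ (subst (λ t → suc t < len h) (sym (toℕ-fromℕ< k<len)) k+1<len ,
                                                              cong suc (sym (toℕ-fromℕ< k<len)))))
                    (sym eq))
      where
      k+1<len : suc k < len h
      k+1<len = subst (_< len h) eq (toℕ<n j)
      k<len : k < len h
      k<len = <-trans (n<1+n k) k+1<len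

    module Rotation (h : Hole G) = Reindex h sucMod
      (λ i j e → toℕ-injective (SucMod-injective (sucMod-spec i) (subst (SucMod (len h) (toℕ j)) (cong toℕ (sym e)) (sucMod-spec j))))
      (λ i j → sucMod-reflects-adj (1<len h) (sucMod-spec i) (sucMod-spec j))
      (λ i j → sucMod-preserves-adj (1<len h) (sucMod-spec i) (sucMod-spec j))
      (sucMod-surjective h)

    module Reflection (h : Hole G) = Reindex h negMod
      (λ i j e → toℕ-injective (NegMod-injective (negMod-spec i) (subst (NegMod (len h) (toℕ j)) (cong toℕ (sym e)) (negMod-spec j))))
      (λ i j → NegMod-reflects-adj (negMod-spec i) (negMod-spec j))
      (λ i j → NegMod-preserves-adj (negMod-spec i) (negMod-spec j))
      (λ j → negMod j , toℕ-injective (NegMod-functional (negMod-spec (negMod j)) (NegMod-sym (negMod-spec j))))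

  rotateHole : Hole G → Hole G
  rotateHole = Rotation.hole

  rotate-same : (h : Hole G) → SameHole h (rotateHole h)
  rotate-same = Rotation.same

  reflectHole : Hole G → Hole G
  reflectHole = Reflection.hole

  reflect-same : (h : Hole G) → SameHole h (reflectHole h)
  reflect-same = Reflection.same

  -- Rotating k times moves the vertex at position k to position 0.
  rootAtIndex : (h : Hole G) (k : ℕ) (i : Fin (len h)) → toℕ i ≡ k →
                Σ (Hole G) λ h′ → SameHole h h′ × v0 h′ ≡ vtx h i
  rootAtIndex h zero i eq = h , SameHole-refl h , sym (vtx≡at h i (0<len h) eq)
  rootAtIndex h (suc k) i eq with rootAtIndex (rotateHole h) k (fromℕ< k<len) (toℕ-fromℕ< k<len)
    where
    k<len : k < len h
    k<len = <-trans (n<1+n k) (subst (_< len h) eq (toℕ<n i))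
  ... | h′ , same , v0≡ = h′ , SameHole-trans {h} {rotateHole h} {h′} (rotate-same h) same , trans v0≡ (cong (vtx h) sucMod-i′)
    where
    k+1<len : suc k < len h
    k+1<len = subst (_< len h) eq (toℕ<n i)
    k<len : k < len h
    k<len = <-trans (n<1+n k) k+1<len
    sucMod-i′ : sucMod (fromℕ< k<len) ≡ i
    sucMod-i′ = toℕ-injective (SucMod-functional (sucMod-spec _)
                  (inj₂ (subst (λ t → suc t < len h) (sym (toℕ-fromℕ< k<len)) k+1<len ,
                         trans eq (cong suc (sym (toℕ-fromℕ< k<len))))))

  rootAt : (h : Hole G) (x : Fin n) → x ∈Hole h → Σ (Hole G) λ h′ → SameHole h h′ × v0 h′ ≡ x
  rootAt h x (i , vtx≡x) with rootAtIndex h (toℕ i) i refl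
  ... | h′ , same , v0≡ = h′ , same , trans v0≡ vtx≡x

  reflect-v0 : (h : Hole G) → v0 (reflectHole h) ≡ v0 h
  reflect-v0 h = cong (vtx h) (toℕ-injective (NegMod-functional (negMod-spec (fromℕ< (0<len h)))
                   (toℕ<n (fromℕ< (0<len h)) , inj₁ (toℕ-fromℕ< (0<len h) , toℕ-fromℕ< (0<len h)))))

  reflect-vlast : (h : Hole G) → vlast (reflectHole h) ≡ v1 h
  reflect-vlast h = cong (vtx h) (toℕ-injective (NegMod-functional (negMod-spec (fromℕ< (len∸1<len h)))
                      (toℕ<n (fromℕ< (len∸1<len h)) ,
                       inj₂ (subst (0 <_) (sym (toℕ-fromℕ< (len∸1<len h))) (1≤len∸1 h) ,
                             trans (cong₂ _+_ (toℕ-fromℕ< (1<len h)) (toℕ-fromℕ< (len∸1<len h))) (suc[len∸1]≡len h)))))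

  reflect-v1 : (h : Hole G) → v1 (reflectHole h) ≡ vlast h
  reflect-v1 h = cong (vtx h) (toℕ-injective (NegMod-functional (negMod-spec (fromℕ< (1<len h)))
                   (toℕ<n (fromℕ< (1<len h)) ,
                    inj₂ (subst (0 <_) (sym (toℕ-fromℕ< (1<len h))) (s≤s z≤n) ,
                          trans (cong₂ _+_ (toℕ-fromℕ< (len∸1<len h)) (toℕ-fromℕ< (1<len h)))
                                (trans (+-comm (len h ∸ 1) 1) (suc[len∸1]≡len h))))))

  neighbour-v0-index : (h : Hole G) (j : Fin (len h)) → Adj G (v0 h) (vtx h j) → toℕ j ≡ 1 ⊎ suc (toℕ j) ≡ len h
  neighbour-v0-index h j e with adj⇒cycleAdj h (fromℕ< (0<len h)) j e
  ... | c rewrite toℕ-fromℕ< (0<len h) with c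
  ... | inj₁ p = inj₁ p
  ... | inj₂ (inj₂ (inj₁ (_ , q))) = inj₂ q
  ... | inj₂ (inj₂ (inj₂ (_ , q))) = ⊥-elim (<-irrefl q (1<len h))

  neighbour-v0 : (h : Hole G) (y : Fin n) → y ∈Hole h → Adj G (v0 h) y → y ≡ v1 h ⊎ y ≡ vlast h
  neighbour-v0 h y (j , refl) e with neighbour-v0-index h j e
  ... | inj₁ p = inj₁ (vtx≡at h j (1<len h) p)
  ... | inj₂ q = inj₂ (vtx≡at h j (len∸1<len h) (trans (sym (m+n∸m≡n 1 (toℕ j))) (cong (_∸ 1) q)))

  rootAtEdge : (h : Hole G) (x y : Fin n) → x ∈Hole h → y ∈Hole h → Adj G x y →
               Σ (Hole G) λ h′ → SameHole h h′ × v0 h′ ≡ x × vlast h′ ≡ y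
  rootAtEdge h x y x∈ y∈ e with rootAt h x x∈
  ... | h₁ , same₁ , refl with neighbour-v0 h₁ y (Equivalence.to (same₁ y) y∈) e
  ...   | inj₂ q = h₁ , same₁ , refl , sym q
  ...   | inj₁ q = reflectHole h₁ , SameHole-trans {h} {h₁} {reflectHole h₁} same₁ (reflect-same h₁) ,
                   reflect-v0 h₁ , trans (reflect-vlast h₁) (sym q)

  ¬adj-v1-vlast : (h : Hole G) → ¬ Adj G (v1 h) (vlast h)
  ¬adj-v1-vlast h e with adj⇒cycleAdj h (fromℕ< (1<len h)) (fromℕ< (len∸1<len h)) e
  ... | c rewrite toℕ-fromℕ< (1<len h) | toℕ-fromℕ< (len∸1<len h) = cycleAdj-gap (2<len∸1 h) (inj₁ (s≤s z≤n)) c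

  triangle-free : (h : Hole G) (x y z : Fin n) → x ∈Hole h → y ∈Hole h → z ∈Hole h →
                  Adj G x y → Adj G x z → ¬ Adj G y z
  triangle-free h x y z x∈ y∈ z∈ xy xz yz with rootAt h x x∈
  ... | h₁ , same , refl with neighbour-v0 h₁ y (Equivalence.to (same y) y∈) xy | neighbour-v0 h₁ z (Equivalence.to (same z) z∈) xz
  ... | inj₁ refl | inj₁ refl = adj-irrefl G yz
  ... | inj₁ refl | inj₂ refl = ¬adj-v1-vlast h₁ yz
  ... | inj₂ refl | inj₁ refl = ¬adj-v1-vlast h₁ (adj-sym G yz)
  ... | inj₂ refl | inj₂ refl = adj-irrefl G yz

  InSegment : (h : Hole G) → ℕ → ℕ → Fin n → Set
  InSegment h lo hi v = Σ (Fin (len h)) λ i → vtx h i ≡ v × lo ≤ toℕ i × toℕ i < hi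

  at∈segment : (h : Hole G) {lo hi k : ℕ} (k<len : k < len h) → lo ≤ k → k < hi → InSegment h lo hi (at h k k<len)
  at∈segment h k<len lo≤k k<hi =
    fromℕ< k<len , refl , subst (_ ≤_) (sym (toℕ-fromℕ< k<len)) lo≤k , subst (_< _) (sym (toℕ-fromℕ< k<len)) k<hi

  segment : (h : Hole G) (lo hi : ℕ) → lo < hi → hi ≤ len h → ConnectedSet G
  segment h lo hi lo<hi hi≤len = record
    { Mem = InSegment h lo hi
    ; mem? = λ v → any? λ i → (vtx h i ≟F v) ×-dec ((lo ≤? toℕ i) ×-dec (toℕ i <? hi))
    ; root = at h lo lo<len
    ; mem-root = at∈segment h lo<len ≤-refl lo<hi
    ; path = λ { v (i , refl , lo≤i , i<hi) → subst (λ t → Star (InducedStep G (InSegment h lo hi)) t (at h lo lo<len))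
                                                   (sym (at-toℕ h i)) (walk (toℕ i) (toℕ<n i) lo≤i i<hi) }
    }
    where
    lo<len : lo < len h
    lo<len = <-≤-trans lo<hi hi≤len
    walk : ∀ k (k<len : k < len h) → lo ≤ k → k < hi → Star (InducedStep G (InSegment h lo hi)) (at h k k<len) (at h lo lo<len)
    walk k k<len lo≤k k<hi with k ≟ lo
    ... | yes refl = ε
    walk zero k<len z≤n _ | no k≢lo = ⊥-elim (k≢lo refl)
    walk (suc k) k+1<len lo≤k+1 k+1<hi | no k+1≢lo =
      (at∈segment h k+1<len lo≤k+1 k+1<hi , at∈segment h k<len lo≤k (<-trans (n<1+n k) k+1<hi) ,
       adj-sym G (adj-suc h k k+1<len)) ◅ walk k k<len lo≤k (<-trans (n<1+n k) k+1<hi)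
      where
      k<len : k < len h
      k<len = <-trans (n<1+n k) k+1<len
      lo≤k : lo ≤ k
      lo≤k = ≤-pred (≤∧≢⇒< lo≤k+1 (k+1≢lo ∘ sym))

  segment⊆hole : (h : Hole G) {lo hi : ℕ} {x : Fin n} → InSegment h lo hi x → x ∈Hole h
  segment⊆hole h (i , eq , _) = i , eq

  segment-mono : (h : Hole G) {lo hi lo′ hi′ : ℕ} {x : Fin n} → lo′ ≤ lo → hi ≤ hi′ →
                 InSegment h lo hi x → InSegment h lo′ hi′ x
  segment-mono h lo′≤lo hi≤hi′ (i , eq , lo≤i , i<hi) = i , eq , ≤-trans lo′≤lo lo≤i , <-≤-trans i<hi hi≤hi′

  segments-disjoint : (h : Hole G) {lo₁ hi₁ lo₂ hi₂ : ℕ} {x y : Fin n} →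
                      InSegment h lo₁ hi₁ x → InSegment h lo₂ hi₂ y → hi₁ ≤ lo₂ → x ≢ y
  segments-disjoint h (i , refl , _ , i<hi₁) (j , refl , lo₂≤j , _) hi₁≤lo₂ eq with injective h i j eq
  ... | refl = <-irrefl refl (<-≤-trans i<hi₁ (≤-trans hi₁≤lo₂ lo₂≤j))

  segments-nonadjacent : (h : Hole G) {lo₁ hi₁ lo₂ hi₂ : ℕ} {x y : Fin n} →
                         InSegment h lo₁ hi₁ x → InSegment h lo₂ hi₂ y →
                         suc hi₁ ≤ lo₂ → (0 < lo₁ ⊎ hi₂ < len h) → ¬ Adj G x y
  segments-nonadjacent h (i , refl , lo₁≤i , i<hi₁) (j , refl , lo₂≤j , j<hi₂) gap not-ends e =
    cycleAdj-gap (≤-trans (s≤s i<hi₁) (≤-trans gap lo₂≤j)) (not-ends′ not-ends) (adj⇒cycleAdj h i j e)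
    where
    not-ends′ : _ → 0 < toℕ i ⊎ suc (toℕ j) < len h
    not-ends′ (inj₁ 0<lo₁) = inj₁ (≤-trans 0<lo₁ lo₁≤i)
    not-ends′ (inj₂ hi₂<len) = inj₂ (≤-trans (s≤s j<hi₂) hi₂<len)

  index≢last : (h : Hole G) {i hi : ℕ} → hi ≤ len h ∸ 1 → i < hi → suc i ≢ len h
  index≢last h hi≤ i<hi eq = <-irrefl eq (≤-trans (s≤s (≤-trans i<hi hi≤)) (≤-reflexive (suc[len∸1]≡len h)))

  segment≢v0 : (h : Hole G) {lo hi : ℕ} {x : Fin n} → InSegment h lo hi x → 1 ≤ lo → x ≢ v0 h
  segment≢v0 h (i , refl , lo≤i , _) 1≤lo eq = index≢0 1≤lo lo≤i (index-v0 h i eq)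

  ≢v0⇒segment : (h : Hole G) {x : Fin n} → x ∈Hole h → x ≢ v0 h → InSegment h 1 (len h) x
  ≢v0⇒segment h (j , refl) x≢v0 with toℕ j in eq
  ... | zero = ⊥-elim (x≢v0 (vtx≡at h j (0<len h) eq))
  ... | suc _ = j , refl , subst (1 ≤_) (sym eq) (s≤s z≤n) , toℕ<n j

  segment[0,1]≡v0 : (h : Hole G) {x : Fin n} → InSegment h 0 1 x → x ≡ v0 h
  segment[0,1]≡v0 h (i , refl , _ , i<1) = vtx≡at h i (0<len h) (n≤0⇒n≡0 (≤-pred i<1))

  segment[1,2]≡v1 : (h : Hole G) {x : Fin n} → InSegment h 1 2 x → x ≡ v1 h
  segment[1,2]≡v1 h (i , refl , 1≤i , i<2) = vtx≡at h i (1<len h) (≤-antisym (≤-pred i<2) 1≤i)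

  segment-last≡vlast : (h : Hole G) {x : Fin n} → InSegment h (len h ∸ 1) (len h) x → x ≡ vlast h
  segment-last≡vlast h (i , refl , lo≤i , i<len) =
    vtx≡at h i (len∸1<len h) (≤-antisym (≤-pred (≤-trans i<len (≤-reflexive (sym (suc[len∸1]≡len h))))) lo≤i)

  v0≢vlast : (h : Hole G) → v0 h ≢ vlast h
  v0≢vlast h eq = index≢0 (1≤len∸1 h) ≤-refl (trans (sym (toℕ-fromℕ< (len∸1<len h))) (index-v0 h _ (sym eq)))

  inner-index : (h : Hole G) (i : Fin (len h)) → 2 ≤ toℕ i → toℕ i < len h ∸ 1 →
                ¬ (toℕ i ≡ 0 ⊎ toℕ i ≡ 1 ⊎ suc (toℕ i) ≡ len h)
  inner-index h i 2≤i _ (inj₁ q) = index≢0 (s≤s z≤n) 2≤i q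
  inner-index h i 2≤i _ (inj₂ (inj₁ q)) = <-irrefl (sym q) 2≤i
  inner-index h i _ i<len∸1 (inj₂ (inj₂ q)) = index≢last h ≤-refl i<len∸1 q

  wholeHole : Hole G → ConnectedSet G
  wholeHole h = segment h 0 (len h) (0<len h) ≤-refl

  ∈wholeHole : (h : Hole G) {x : Fin n} → x ∈Hole h → Mem (wholeHole h) x
  ∈wholeHole h (i , refl) = i , refl , z≤n , toℕ<n i

-- Configurations containing the forbidden induced minors

module _ {n : ℕ} {G : Graph n} where

  -- The two 4-cycles of F2: positions 1, 2 … len-2 and len-1 of each hole, around Z.
  module TwoHolesJoinedAt (C D : Hole G) (Z : ConnectedSet G)
    (v0C∈Z : Mem Z (v0 C)) (v0D∈Z : Mem Z (v0 D))
    (Z∩C : ∀ x → Mem Z x → x ∈Hole C → x ≡ v0 C)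
    (Z∩D : ∀ x → Mem Z x → x ∈Hole D → x ≡ v0 D)
    (C∩D⊆Z : ∀ x → x ∈Hole C → x ∈Hole D → Mem Z x)
    (Z-to-C : ∀ z (i : Fin (len C)) → Mem Z z → Adj G z (vtx C i) → toℕ i ≡ 0 ⊎ toℕ i ≡ 1 ⊎ suc (toℕ i) ≡ len C)
    (Z-to-D : ∀ z (i : Fin (len D)) → Mem Z z → Adj G z (vtx D i) → toℕ i ≡ 0 ⊎ toℕ i ≡ 1 ⊎ suc (toℕ i) ≡ len D)
    (C-to-D : ∀ i j → 1 ≤ toℕ i → 1 ≤ toℕ j → ¬ Adj G (vtx C i) (vtx D j)) where

    branch : Fin 7 → ConnectedSet G
    branch zero = segment C 1 2 (s≤s (s≤s z≤n)) (1<len C)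
    branch (suc zero) = segment C 2 (len C ∸ 1) (2<len∸1 C) (m∸n≤m (len C) 1)
    branch (suc (suc zero)) = segment C (len C ∸ 1) (len C) (len∸1<len C) ≤-refl
    branch (suc (suc (suc zero))) = Z
    branch (suc (suc (suc (suc zero)))) = segment D 1 2 (s≤s (s≤s z≤n)) (1<len D)
    branch (suc (suc (suc (suc (suc zero))))) = segment D 2 (len D ∸ 1) (2<len∸1 D) (m∸n≤m (len D) 1)
    branch (suc (suc (suc (suc (suc (suc zero)))))) = segment D (len D ∸ 1) (len D) (len∸1<len D) ≤-refl

    open F2Model branch hiding (F2≤im)

    C∉Z : ∀ {lo hi x y} → InSegment C lo hi x → 1 ≤ lo → Mem Z y → x ≢ y
    C∉Z x∈ 1≤lo y∈Z refl = segment≢v0 C x∈ 1≤lo (Z∩C _ y∈Z (segment⊆hole C x∈))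

    D∉Z : ∀ {lo hi x y} → Mem Z x → InSegment D lo hi y → 1 ≤ lo → x ≢ y
    D∉Z x∈Z y∈ 1≤lo refl = segment≢v0 D y∈ 1≤lo (Z∩D _ x∈Z (segment⊆hole D y∈))

    C-sep-D : ∀ {lo₁ hi₁ lo₂ hi₂ x y} → InSegment C lo₁ hi₁ x → 1 ≤ lo₁ → InSegment D lo₂ hi₂ y → 1 ≤ lo₂ →
              x ≢ y × ¬ Adj G x y
    C-sep-D x∈@(i , refl , lo₁≤i , _) 1≤lo₁ (j , refl , lo₂≤j , _) 1≤lo₂ =
      (λ x≡y → segment≢v0 C x∈ 1≤lo₁ (Z∩C _ (C∩D⊆Z _ (segment⊆hole C x∈) (j , sym x≡y)) (segment⊆hole C x∈))) ,
      C-to-D i j (≤-trans 1≤lo₁ lo₁≤i) (≤-trans 1≤lo₂ lo₂≤j)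

    inner-C≁Z : ∀ {x y} → InSegment C 2 (len C ∸ 1) x → Mem Z y → ¬ Adj G x y
    inner-C≁Z (i , refl , 2≤i , i<) y∈Z e = inner-index C i 2≤i i< (Z-to-C _ i y∈Z (adj-sym G e))

    Z≁inner-D : ∀ {x y} → Mem Z x → InSegment D 2 (len D ∸ 1) y → ¬ Adj G x y
    Z≁inner-D x∈Z (i , refl , 2≤i , i<) e = inner-index D i 2≤i i< (Z-to-D _ i x∈Z e)

    1≤2 : 1 ≤ 2
    1≤2 = s≤s z≤n

    separated : All Separated (orderedPairs 7)
    separated =
        (λ x y x∈ y∈ → segments-disjoint C x∈ y∈ ≤-refl)
      ∷ (λ x y x∈ y∈ → segments-disjoint C x∈ y∈ (≤-trans (s≤s (s≤s z≤n)) (2<len∸1 C)) ,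
                        segments-nonadjacent C x∈ y∈ (2<len∸1 C) (inj₁ (s≤s z≤n)))
      ∷ (λ x y x∈ y∈ → C∉Z x∈ ≤-refl y∈)
      ∷ (λ x y x∈ y∈ → C-sep-D x∈ ≤-refl y∈ ≤-refl)
      ∷ (λ x y x∈ y∈ → C-sep-D x∈ ≤-refl y∈ 1≤2)
      ∷ (λ x y x∈ y∈ → C-sep-D x∈ ≤-refl y∈ (1≤len∸1 D))
      ∷ (λ x y x∈ y∈ → segments-disjoint C x∈ y∈ ≤-refl)
      ∷ (λ x y x∈ y∈ → C∉Z x∈ 1≤2 y∈ , inner-C≁Z x∈ y∈)
      ∷ (λ x y x∈ y∈ → C-sep-D x∈ 1≤2 y∈ ≤-refl)
      ∷ (λ x y x∈ y∈ → C-sep-D x∈ 1≤2 y∈ 1≤2)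
      ∷ (λ x y x∈ y∈ → C-sep-D x∈ 1≤2 y∈ (1≤len∸1 D))
      ∷ (λ x y x∈ y∈ → C∉Z x∈ (1≤len∸1 C) y∈)
      ∷ (λ x y x∈ y∈ → C-sep-D x∈ (1≤len∸1 C) y∈ ≤-refl)
      ∷ (λ x y x∈ y∈ → C-sep-D x∈ (1≤len∸1 C) y∈ 1≤2)
      ∷ (λ x y x∈ y∈ → C-sep-D x∈ (1≤len∸1 C) y∈ (1≤len∸1 D))
      ∷ (λ x y x∈ y∈ → D∉Z x∈ y∈ ≤-refl)
      ∷ (λ x y x∈ y∈ → D∉Z x∈ y∈ 1≤2 , Z≁inner-D x∈ y∈)
      ∷ (λ x y x∈ y∈ → D∉Z x∈ y∈ (1≤len∸1 D))
      ∷ (λ x y x∈ y∈ → segments-disjoint D x∈ y∈ ≤-refl)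
      ∷ (λ x y x∈ y∈ → segments-disjoint D x∈ y∈ (≤-trans (s≤s (s≤s z≤n)) (2<len∸1 D)) ,
                        segments-nonadjacent D x∈ y∈ (2<len∸1 D) (inj₁ (s≤s z≤n)))
      ∷ (λ x y x∈ y∈ → segments-disjoint D x∈ y∈ ≤-refl)
      ∷ []

    touching : All TouchingPair F2-edges
    touching =
        (v1 C , at C 2 (2<len C) , at∈segment C (1<len C) ≤-refl ≤-refl , at∈segment C (2<len C) ≤-refl (2<len∸1 C) ,
         adj-suc C 1 (2<len C))
      ∷ (at C (len C ∸ 2) (len∸2<len C) , vlast C , at∈segment C (len∸2<len C) (2≤len∸2 C) (len∸2<len∸1 C) ,
         at∈segment C (len∸1<len C) ≤-refl (len∸1<len C) , adjAt C (len∸2<len C) (len∸1<len C) (inj₁ (sym (suc[len∸2]≡len∸1 C))))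
      ∷ (vlast C , v0 C , at∈segment C (len∸1<len C) ≤-refl (len∸1<len C) , v0C∈Z , adj-vlast-v0 C)
      ∷ (v0 C , v1 C , v0C∈Z , at∈segment C (1<len C) ≤-refl ≤-refl , adj-v0-v1 C)
      ∷ (v0 D , v1 D , v0D∈Z , at∈segment D (1<len D) ≤-refl ≤-refl , adj-v0-v1 D)
      ∷ (v1 D , at D 2 (2<len D) , at∈segment D (1<len D) ≤-refl ≤-refl , at∈segment D (2<len D) ≤-refl (2<len∸1 D) ,
         adj-suc D 1 (2<len D))
      ∷ (at D (len D ∸ 2) (len∸2<len D) , vlast D , at∈segment D (len∸2<len D) (2≤len∸2 D) (len∸2<len∸1 D) ,
         at∈segment D (len∸1<len D) ≤-refl (len∸1<len D) , adjAt D (len∸2<len D) (len∸1<len D) (inj₁ (sym (suc[len∸2]≡len∸1 D))))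
      ∷ (vlast D , v0 D , at∈segment D (len∸1<len D) ≤-refl (len∸1<len D) , v0D∈Z , adj-vlast-v0 D)
      ∷ []

    F2≤im : F2 ≤im G
    F2≤im = F2Model.F2≤im branch separated touching

  module HoleWithHandle (C : Hole G) (U W : ConnectedSet G)
    (U∩C : ∀ x → Mem U x → ¬ x ∈Hole C) (W∩C : ∀ x → Mem W x → ¬ x ∈Hole C)
    (U∩W : ∀ x → Mem U x → ¬ Mem W x)
    (U-W : Touching U W)
    (U-v0 : AttachedTo U (v0 C)) (W-vlast : AttachedTo W (vlast C))
    (U-to-C : ∀ u i → Mem U u → Adj G u (vtx C i) → toℕ i ≡ 0)
    (W-to-C : ∀ w i → Mem W w → Adj G w (vtx C i) → suc (toℕ i) ≡ len C) where

    branch : Fin 6 → ConnectedSet G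
    branch zero = U
    branch (suc zero) = segment C 0 1 (s≤s z≤n) (0<len C)
    branch (suc (suc zero)) = segment C 1 2 (s≤s (s≤s z≤n)) (1<len C)
    branch (suc (suc (suc zero))) = W
    branch (suc (suc (suc (suc zero)))) = segment C (len C ∸ 1) (len C) (len∸1<len C) ≤-refl
    branch (suc (suc (suc (suc (suc zero))))) = segment C 2 (len C ∸ 1) (2<len∸1 C) (m∸n≤m (len C) 1)

    open F1Model branch hiding (F1≤im)

    U∉C : ∀ {lo hi x y} → Mem U x → InSegment C lo hi y → x ≢ y
    U∉C x∈U y∈ refl = U∩C _ x∈U (segment⊆hole C y∈)

    W∉C : ∀ {lo hi x y} → InSegment C lo hi x → Mem W y → x ≢ y
    W∉C x∈ y∈W refl = W∩C _ y∈W (segment⊆hole C x∈)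

    U≁C : ∀ {lo hi x y} → 1 ≤ lo → Mem U x → InSegment C lo hi y → ¬ Adj G x y
    U≁C 1≤lo x∈U (i , refl , lo≤i , _) e = index≢0 1≤lo lo≤i (U-to-C _ i x∈U e)

    C≁W : ∀ {lo hi x y} → hi ≤ len C ∸ 1 → InSegment C lo hi x → Mem W y → ¬ Adj G x y
    C≁W hi≤ (i , refl , _ , i<hi) y∈W e = index≢last C hi≤ i<hi (W-to-C _ i y∈W (adj-sym G e))

    separated : All Separated (orderedPairs 6)
    separated =
        (λ x y x∈ y∈ → U∉C x∈ y∈)
      ∷ (λ x y x∈ y∈ → U∉C x∈ y∈ , U≁C (s≤s z≤n) x∈ y∈)
      ∷ (λ x y x∈ y∈ x≡y → U∩W x x∈ (subst (Mem W) (sym x≡y) y∈))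
      ∷ (λ x y x∈ y∈ → U∉C x∈ y∈ , U≁C (1≤len∸1 C) x∈ y∈)
      ∷ (λ x y x∈ y∈ → U∉C x∈ y∈ , U≁C (s≤s z≤n) x∈ y∈)
      ∷ (λ x y x∈ y∈ → segments-disjoint C x∈ y∈ ≤-refl)
      ∷ (λ x y x∈ y∈ → W∉C x∈ y∈ , C≁W (1≤len∸1 C) x∈ y∈)
      ∷ (λ x y x∈ y∈ → segments-disjoint C x∈ y∈ (1≤len∸1 C))
      ∷ (λ x y x∈ y∈ → segments-disjoint C x∈ y∈ (s≤s z≤n) , segments-nonadjacent C x∈ y∈ ≤-refl (inj₂ (len∸1<len C)))
      ∷ (λ x y x∈ y∈ → W∉C x∈ y∈ , C≁W (<⇒≤ (2<len∸1 C)) x∈ y∈)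
      ∷ (λ x y x∈ y∈ → segments-disjoint C x∈ y∈ (<⇒≤ (2<len∸1 C)) , segments-nonadjacent C x∈ y∈ (2<len∸1 C) (inj₁ (s≤s z≤n)))
      ∷ (λ x y x∈ y∈ → segments-disjoint C x∈ y∈ ≤-refl)
      ∷ (λ x y x∈ y∈ x≡y → W∉C y∈ x∈ (sym x≡y))
      ∷ (λ x y x∈ y∈ → (λ x≡y → W∉C y∈ x∈ (sym x≡y)) , λ e → C≁W ≤-refl y∈ x∈ (adj-sym G e))
      ∷ (λ x y x∈ y∈ x≡y → segments-disjoint C y∈ x∈ ≤-refl (sym x≡y))
      ∷ []

    touching : All TouchingPair F1-edges
    touching =
        (let (u , u∈ , e) = U-v0 in u , v0 C , u∈ , at∈segment C (0<len C) z≤n (s≤s z≤n) , adj-sym G e)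
      ∷ (v0 C , v1 C , at∈segment C (0<len C) z≤n (s≤s z≤n) , at∈segment C (1<len C) ≤-refl ≤-refl , adj-v0-v1 C)
      ∷ (let (w , w∈ , e) = W-vlast in w , vlast C , w∈ , at∈segment C (len∸1<len C) ≤-refl (len∸1<len C) , adj-sym G e)
      ∷ (vlast C , at C (len C ∸ 2) (len∸2<len C) , at∈segment C (len∸1<len C) ≤-refl (len∸1<len C) ,
         at∈segment C (len∸2<len C) (2≤len∸2 C) (len∸2<len∸1 C) ,
         adjAt C (len∸1<len C) (len∸2<len C) (inj₂ (inj₁ (sym (suc[len∸2]≡len∸1 C)))))
      ∷ U-W
      ∷ (v0 C , vlast C , at∈segment C (0<len C) z≤n (s≤s z≤n) , at∈segment C (len∸1<len C) ≤-refl (len∸1<len C) ,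
         adj-sym G (adj-vlast-v0 C))
      ∷ (v1 C , at C 2 (2<len C) , at∈segment C (1<len C) ≤-refl ≤-refl , at∈segment C (2<len C) ≤-refl (2<len∸1 C) ,
         adj-suc C 1 (2<len C))
      ∷ []

    F1≤im : F1 ≤im G
    F1≤im = F1Model.F1≤im branch separated touching

  module HolesLinkedAtVertex (C D : Hole G) (v0≡v0 : v0 C ≡ v0 D)
    (C∩D : ∀ x → x ∈Hole C → x ∈Hole D → x ≡ v0 C)
    (C-to-D : ∀ x y → x ∈Hole C → x ≢ v0 C → y ∈Hole D → y ≢ v0 D → y ≢ vlast D → ¬ Adj G x y)
    (vlastD-to-C : ∀ x → x ∈Hole C → x ≢ v0 C → x ≢ v1 C → ¬ Adj G (vlast D) x)
    (vlastD-v1C : Adj G (vlast D) (v1 C)) where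

    v1C∈ : InSegment C 1 2 (v1 C)
    v1C∈ = at∈segment C (1<len C) ≤-refl ≤-refl

    vlastD∈ : InSegment D (len D ∸ 1) (len D) (vlast D)
    vlastD∈ = at∈segment D (len∸1<len D) ≤-refl (len∸1<len D)

    v0C∈ : InSegment C 0 1 (v0 C)
    v0C∈ = at∈segment C (0<len C) z≤n (s≤s z≤n)

    branch : Fin 6 → ConnectedSet G
    branch zero = segment C 3 (len C) (len≥4 C) ≤-refl
    branch (suc zero) = segment C 0 1 (s≤s z≤n) (0<len C)
    branch (suc (suc zero)) = segment D 1 2 (s≤s (s≤s z≤n)) (1<len D)
    branch (suc (suc (suc zero))) = segment C 2 3 ≤-refl (2<len C)
    branch (suc (suc (suc (suc zero)))) =
      union (segment C 1 2 (s≤s (s≤s z≤n)) (1<len C)) (segment D (len D ∸ 1) (len D) (len∸1<len D) ≤-refl)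
            (v1 C) (vlast D) v1C∈ vlastD∈ (inj₂ (adj-sym G vlastD-v1C))
    branch (suc (suc (suc (suc (suc zero))))) = segment D 2 (len D ∸ 1) (2<len∸1 D) (m∸n≤m (len D) 1)

    open F1Model branch hiding (F1≤im)

    C≢D : ∀ {lo₁ hi₁ lo₂ hi₂ x y} → InSegment C lo₁ hi₁ x → 1 ≤ lo₁ → InSegment D lo₂ hi₂ y → x ≢ y
    C≢D x∈ 1≤lo y∈ refl = segment≢v0 C x∈ 1≤lo (C∩D _ (segment⊆hole C x∈) (segment⊆hole D y∈))

    C≁D : ∀ {lo₁ hi₁ lo₂ hi₂ x y} → InSegment C lo₁ hi₁ x → 1 ≤ lo₁ → InSegment D lo₂ hi₂ y → 1 ≤ lo₂ →
          hi₂ ≤ len D ∸ 1 → ¬ Adj G x y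
    C≁D x∈ 1≤lo₁ y∈ 1≤lo₂ hi₂≤ = C-to-D _ _ (segment⊆hole C x∈) (segment≢v0 C x∈ 1≤lo₁) (segment⊆hole D y∈)
                                   (segment≢v0 D y∈ 1≤lo₂) (segments-disjoint D y∈ vlastD∈ hi₂≤)

    v0C→D : ∀ {x} → InSegment C 0 1 x → InSegment D 0 1 x
    v0C→D x∈ = subst (InSegment D 0 1) (sym (trans (segment[0,1]≡v0 C x∈) v0≡v0)) (at∈segment D (0<len D) z≤n (s≤s z≤n))

    2≤len∸1 : 2 ≤ len D ∸ 1
    2≤len∸1 = <⇒≤ (2<len∸1 D)

    1≤n : ∀ {k} → 1 ≤ suc k
    1≤n = s≤s z≤n

    sep-0-4 : Separated (# 0 , # 4)
    sep-0-4 x y x∈ (inj₁ y∈) = (λ x≡y → segments-disjoint C y∈ x∈ (s≤s (s≤s z≤n)) (sym x≡y)) ,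
                               λ e → segments-nonadjacent C y∈ x∈ ≤-refl (inj₁ 1≤n) (adj-sym G e)
    sep-0-4 x y x∈ (inj₂ y∈) = C≢D x∈ 1≤n y∈ , λ e →
      vlastD-to-C x (segment⊆hole C x∈) (segment≢v0 C x∈ 1≤n) (λ x≡v1 → segments-disjoint C v1C∈ x∈ (s≤s (s≤s z≤n)) (sym x≡v1))
                  (subst (λ t → Adj G t x) (segment-last≡vlast D y∈) (adj-sym G e))

    sep-1-4 : Separated (# 1 , # 4)
    sep-1-4 x y x∈ (inj₁ y∈) = segments-disjoint C x∈ y∈ ≤-refl
    sep-1-4 x y x∈ (inj₂ y∈) x≡y =
      v0≢vlast D (trans (sym (trans (segment[0,1]≡v0 C x∈) v0≡v0)) (trans x≡y (segment-last≡vlast D y∈)))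

    sep-2-4 : Separated (# 2 , # 4)
    sep-2-4 x y x∈ (inj₁ y∈) = (λ x≡y → C≢D y∈ 1≤n x∈ (sym x≡y)) , λ e → C≁D y∈ 1≤n x∈ 1≤n 2≤len∸1 (adj-sym G e)
    sep-2-4 x y x∈ (inj₂ y∈) = segments-disjoint D x∈ y∈ 2≤len∸1 , segments-nonadjacent D x∈ y∈ (2<len∸1 D) (inj₁ 1≤n)

    sep-3-4 : Separated (# 3 , # 4)
    sep-3-4 x y x∈ (inj₁ y∈) x≡y = segments-disjoint C y∈ x∈ ≤-refl (sym x≡y)
    sep-3-4 x y x∈ (inj₂ y∈) = C≢D x∈ 1≤n y∈

    sep-4-5 : Separated (# 4 , # 5)
    sep-4-5 x y (inj₁ x∈) y∈ = C≢D x∈ 1≤n y∈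
    sep-4-5 x y (inj₂ x∈) y∈ x≡y = segments-disjoint D y∈ x∈ ≤-refl (sym x≡y)

    separated : All Separated (orderedPairs 6)
    separated =
        (λ x y x∈ y∈ x≡y → segments-disjoint C y∈ x∈ 1≤n (sym x≡y))
      ∷ (λ x y x∈ y∈ → C≢D x∈ 1≤n y∈ , C≁D x∈ 1≤n y∈ ≤-refl 2≤len∸1)
      ∷ (λ x y x∈ y∈ x≡y → segments-disjoint C y∈ x∈ ≤-refl (sym x≡y))
      ∷ sep-0-4
      ∷ (λ x y x∈ y∈ → C≢D x∈ 1≤n y∈ , C≁D x∈ 1≤n y∈ 1≤n ≤-refl)
      ∷ (λ x y x∈ y∈ → segments-disjoint D (v0C→D x∈) y∈ 1≤n)
      ∷ (λ x y x∈ y∈ → segments-disjoint C x∈ y∈ 1≤n , segments-nonadjacent C x∈ y∈ ≤-refl (inj₂ (len≥4 C)))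
      ∷ sep-1-4
      ∷ (λ x y x∈ y∈ → segments-disjoint D (v0C→D x∈) y∈ 1≤n , segments-nonadjacent D (v0C→D x∈) y∈ ≤-refl (inj₂ (len∸1<len D)))
      ∷ (λ x y x∈ y∈ → (λ x≡y → C≢D y∈ 1≤n x∈ (sym x≡y)) , λ e → C≁D y∈ 1≤n x∈ 1≤n 2≤len∸1 (adj-sym G e))
      ∷ sep-2-4
      ∷ (λ x y x∈ y∈ → segments-disjoint D x∈ y∈ ≤-refl)
      ∷ sep-3-4
      ∷ (λ x y x∈ y∈ → C≢D x∈ 1≤n y∈ , C≁D x∈ 1≤n y∈ 1≤n ≤-refl)
      ∷ sep-4-5
      ∷ []

    touching : All TouchingPair F1-edges
    touching =
        (vlast C , v0 C , at∈segment C (len∸1<len C) (2<len∸1 C) (len∸1<len C) , v0C∈ , adj-vlast-v0 C)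
      ∷ (v0 C , v1 D , v0C∈ , at∈segment D (1<len D) ≤-refl ≤-refl ,
         subst (λ t → Adj G t (v1 D)) (sym v0≡v0) (adj-v0-v1 D))
      ∷ (at C 2 (2<len C) , v1 C , at∈segment C (2<len C) ≤-refl ≤-refl , inj₁ v1C∈ ,
         adjAt C (2<len C) (1<len C) (inj₂ (inj₁ refl)))
      ∷ (vlast D , at D (len D ∸ 2) (len∸2<len D) , inj₂ vlastD∈ ,
         at∈segment D (len∸2<len D) (2≤len∸2 D) (len∸2<len∸1 D) ,
         adjAt D (len∸1<len D) (len∸2<len D) (inj₂ (inj₁ (sym (suc[len∸2]≡len∸1 D)))))
      ∷ (at C 3 (len≥4 C) , at C 2 (2<len C) , at∈segment C (len≥4 C) ≤-refl (len≥4 C) ,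
         at∈segment C (2<len C) ≤-refl ≤-refl , adjAt C (len≥4 C) (2<len C) (inj₂ (inj₁ refl)))
      ∷ (v0 C , v1 C , v0C∈ , inj₁ v1C∈ , adj-v0-v1 C)
      ∷ (v1 D , at D 2 (2<len D) , at∈segment D (1<len D) ≤-refl ≤-refl , at∈segment D (2<len D) ≤-refl (2<len∸1 D) ,
         adj-suc D 1 (2<len D))
      ∷ []

    F1≤im : F1 ≤im G
    F1≤im = F1Model.F1≤im branch separated touching

  module ThreeAttachments (D : Hole G) (S : ConnectedSet G) (S∩D : ∀ x → Mem S x → ¬ x ∈Hole D)
    (t k : ℕ) (t<k : suc t < suc k) (k+1<len : suc k < len D)
    (S-0 : AttachedTo S (v0 D)) (S-t : AttachedTo S (at D (suc t) (<-trans t<k k+1<len)))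
    (S-k : AttachedTo S (at D (suc k) k+1<len)) where

    t+1<len : suc t < len D
    t+1<len = <-trans t<k k+1<len

    t<len : t < len D
    t<len = <-trans (n<1+n t) t+1<len

    k<len : k < len D
    k<len = <-trans (n<1+n k) k+1<len

    branch : Fin 4 → ConnectedSet G
    branch zero = segment D 0 (suc t) (s≤s z≤n) (<⇒≤ t+1<len)
    branch (suc zero) = segment D (suc t) (suc k) t<k (<⇒≤ k+1<len)
    branch (suc (suc zero)) = segment D (suc k) (len D) k+1<len ≤-refl
    branch (suc (suc (suc zero))) = S

    open K4Model branch hiding (K4≤im)

    D∉S : ∀ {lo hi x y} → InSegment D lo hi x → Mem S y → x ≢ y
    D∉S x∈ y∈S refl = S∩D _ y∈S (segment⊆hole D x∈)

    separated : All Separated (orderedPairs 4)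
    separated =
        (λ x y x∈ y∈ → segments-disjoint D x∈ y∈ ≤-refl)
      ∷ (λ x y x∈ y∈ → segments-disjoint D x∈ y∈ (<⇒≤ t<k))
      ∷ (λ x y x∈ y∈ → D∉S x∈ y∈)
      ∷ (λ x y x∈ y∈ → segments-disjoint D x∈ y∈ ≤-refl)
      ∷ (λ x y x∈ y∈ → D∉S x∈ y∈)
      ∷ (λ x y x∈ y∈ → D∉S x∈ y∈)
      ∷ []

    attached : ∀ {lo hi v} → InSegment D lo hi v → AttachedTo S v → Σ (Fin n) λ x → Σ (Fin n) λ y →
               InSegment D lo hi x × Mem S y × Adj G x y
    attached {v = v} v∈ (s , s∈ , e) = v , s , v∈ , s∈ , e

    touching : All TouchingPair (orderedPairs 4)
    touching =
        (at D t t<len , at D (suc t) t+1<len , at∈segment D t<len z≤n ≤-refl , at∈segment D t+1<len ≤-refl t<k , adj-suc D t t+1<len)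
      ∷ (v0 D , vlast D , at∈segment D (0<len D) z≤n (s≤s z≤n) ,
         at∈segment D (len∸1<len D) (≤-pred (≤-trans k+1<len (≤-reflexive (sym (suc[len∸1]≡len D))))) (len∸1<len D) ,
         adj-sym G (adj-vlast-v0 D))
      ∷ attached (at∈segment D (0<len D) z≤n (s≤s z≤n)) S-0
      ∷ (at D k k<len , at D (suc k) k+1<len , at∈segment D k<len (≤-pred t<k) ≤-refl , at∈segment D k+1<len ≤-refl k+1<len ,
         adj-suc D k k+1<len)
      ∷ attached (at∈segment D t+1<len ≤-refl t<k) S-t
      ∷ attached (at∈segment D k+1<len ≤-refl k+1<len) S-k
      ∷ []

    K4≤im : K4 ≤im G
    K4≤im = K4Model.K4≤im branch separated touching

  module TwoAttachments (D : Hole G) (S : ConnectedSet G) (S∩D : ∀ x → Mem S x → ¬ x ∈Hole D)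
    (t : ℕ) (2≤t : 2 ≤ t) (t+1<len : suc t < len D)
    (S-0 : AttachedTo S (v0 D)) (S-t : AttachedTo S (at D t (<-trans (n<1+n t) t+1<len)))
    (S-to-D : ∀ s y → Mem S s → y ∈Hole D → Adj G y s → y ≡ v0 D ⊎ y ≡ at D t (<-trans (n<1+n t) t+1<len)) where

    t<len : t < len D
    t<len = <-trans (n<1+n t) t+1<len

    branch : Fin 5 → ConnectedSet G
    branch zero = segment D 0 1 (s≤s z≤n) (0<len D)
    branch (suc zero) = segment D t (suc t) ≤-refl (<⇒≤ t+1<len)
    branch (suc (suc zero)) = S
    branch (suc (suc (suc zero))) = segment D 1 t 2≤t (<⇒≤ t<len)
    branch (suc (suc (suc (suc zero)))) = segment D (suc t) (len D) t+1<len ≤-refl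

    open K23Model branch hiding (K23≤im)

    D∉S : ∀ {lo hi x y} → InSegment D lo hi x → Mem S y → x ≢ y
    D∉S x∈ y∈S refl = S∩D _ y∈S (segment⊆hole D x∈)

    vt∈ : InSegment D t (suc t) (at D t t<len)
    vt∈ = at∈segment D t<len ≤-refl ≤-refl

    S≁D : ∀ {lo hi x y} → 1 ≤ lo → (hi ≤ t ⊎ suc t ≤ lo) → Mem S x → InSegment D lo hi y → ¬ Adj G x y
    S≁D 1≤lo _ x∈S y∈ e with S-to-D _ _ x∈S (segment⊆hole D y∈) (adj-sym G e)
    ... | inj₁ y≡v0 = segment≢v0 D y∈ 1≤lo y≡v0
    S≁D _ (inj₁ hi≤t) x∈S y∈ e | inj₂ y≡vt = segments-disjoint D y∈ vt∈ hi≤t y≡vt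
    S≁D _ (inj₂ t+1≤lo) x∈S y∈ e | inj₂ y≡vt = segments-disjoint D vt∈ y∈ t+1≤lo (sym y≡vt)

    separated : All Separated (orderedPairs 5)
    separated =
        (λ x y x∈ y∈ → segments-disjoint D x∈ y∈ (≤-trans (s≤s z≤n) 2≤t) , segments-nonadjacent D x∈ y∈ 2≤t (inj₂ t+1<len))
      ∷ (λ x y x∈ y∈ → D∉S x∈ y∈)
      ∷ (λ x y x∈ y∈ → segments-disjoint D x∈ y∈ ≤-refl)
      ∷ (λ x y x∈ y∈ → segments-disjoint D x∈ y∈ (s≤s z≤n))
      ∷ (λ x y x∈ y∈ → D∉S x∈ y∈)
      ∷ (λ x y x∈ y∈ x≡y → segments-disjoint D y∈ x∈ ≤-refl (sym x≡y))
      ∷ (λ x y x∈ y∈ → segments-disjoint D x∈ y∈ ≤-refl)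
      ∷ (λ x y x∈ y∈ → (λ x≡y → D∉S y∈ x∈ (sym x≡y)) , S≁D (s≤s z≤n) (inj₁ ≤-refl) x∈ y∈)
      ∷ (λ x y x∈ y∈ → (λ x≡y → D∉S y∈ x∈ (sym x≡y)) , S≁D (s≤s z≤n) (inj₂ ≤-refl) x∈ y∈)
      ∷ (λ x y x∈ y∈ → segments-disjoint D x∈ y∈ (n≤1+n t) , segments-nonadjacent D x∈ y∈ ≤-refl (inj₁ (s≤s z≤n)))
      ∷ []

    t∸1<len : t ∸ 1 < len D
    t∸1<len = ≤-trans (s≤s (m∸n≤m t 1)) t<len

    suc[t∸1]≡t : suc (t ∸ 1) ≡ t
    suc[t∸1]≡t = trans (+-comm 1 (t ∸ 1)) (m∸n+n≡m (≤-trans (s≤s z≤n) 2≤t))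

    touching : All TouchingPair K23-edges
    touching =
        (let (s , s∈ , e) = S-0 in v0 D , s , at∈segment D (0<len D) z≤n (s≤s z≤n) , s∈ , e)
      ∷ (v0 D , v1 D , at∈segment D (0<len D) z≤n (s≤s z≤n) , at∈segment D (1<len D) ≤-refl 2≤t , adj-v0-v1 D)
      ∷ (v0 D , vlast D , at∈segment D (0<len D) z≤n (s≤s z≤n) ,
         at∈segment D (len∸1<len D) (≤-pred (≤-trans t+1<len (≤-reflexive (sym (suc[len∸1]≡len D))))) (len∸1<len D) ,
         adj-sym G (adj-vlast-v0 D))
      ∷ (let (s , s∈ , e) = S-t in at D t t<len , s , vt∈ , s∈ , e)
      ∷ (at D t t<len , at D (t ∸ 1) t∸1<len , vt∈ ,
         at∈segment D t∸1<len (≤-pred (subst (2 ≤_) (sym suc[t∸1]≡t) 2≤t)) (≤-reflexive suc[t∸1]≡t) ,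
         adjAt D t<len t∸1<len (inj₂ (inj₁ (sym suc[t∸1]≡t))))
      ∷ (at D t t<len , at D (suc t) t+1<len , vt∈ , at∈segment D t+1<len ≤-refl t+1<len , adj-suc D t t+1<len)
      ∷ []

    K23≤im : K23 ≤im G
    K23≤im = K23Model.K23≤im branch separated touching

  clique⇒K4 : (w₀ w₁ w₂ w₃ : Fin n) → Adj G w₀ w₁ → Adj G w₀ w₂ → Adj G w₀ w₃ →
              Adj G w₁ w₂ → Adj G w₁ w₃ → Adj G w₂ w₃ → K4 ≤im G
  clique⇒K4 w₀ w₁ w₂ w₃ e₀₁ e₀₂ e₀₃ e₁₂ e₁₃ e₂₃ = K4Model.K4≤im branch separated touching
    where
    branch : Fin 4 → ConnectedSet G
    branch zero = singleton w₀
    branch (suc zero) = singleton w₁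
    branch (suc (suc zero)) = singleton w₂
    branch (suc (suc (suc zero))) = singleton w₃
    open K4Model branch hiding (K4≤im)
    distinct : ∀ {x y u v} → Adj G u v → x ≡ u → y ≡ v → x ≢ y
    distinct uv refl refl refl = adj-irrefl G uv
    separated : All Separated (orderedPairs 4)
    separated = (λ _ _ → distinct e₀₁) ∷ (λ _ _ → distinct e₀₂) ∷ (λ _ _ → distinct e₀₃)
              ∷ (λ _ _ → distinct e₁₂) ∷ (λ _ _ → distinct e₁₃) ∷ (λ _ _ → distinct e₂₃) ∷ []
    touching : All TouchingPair (orderedPairs 4)
    touching = (w₀ , w₁ , refl , refl , e₀₁) ∷ (w₀ , w₂ , refl , refl , e₀₂) ∷ (w₀ , w₃ , refl , refl , e₀₃)
             ∷ (w₁ , w₂ , refl , refl , e₁₂) ∷ (w₁ , w₃ , refl , refl , e₁₃) ∷ (w₂ , w₃ , refl , refl , e₂₃) ∷ []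

-- Two holes in a {K4, K23, F1, F2}-induced-minor-free graph

module InducedMinorFree {n : ℕ} (G : Graph n) (adj? : ∀ x y → Dec (Adj G x y))
            (¬K4 : ¬ (K4 ≤im G)) (¬K23 : ¬ (K23 ≤im G)) (¬F1 : ¬ (F1 ≤im G)) (¬F2 : ¬ (F2 ≤im G)) where

  attachedTo? : (S : ConnectedSet G) → ∀ y → Dec (AttachedTo S y)
  attachedTo? S y = any? λ s → mem? S s ×-dec adj? y s

  data PositionView (L t : ℕ) : Set where
    first  : t ≡ 0 → PositionView L t
    second : t ≡ 1 → PositionView L t
    last   : suc t ≡ L → PositionView L t
    inner  : 2 ≤ t → suc t < L → PositionView L t

  positionView : ∀ L t → t < L → PositionView L t
  positionView L zero _ = first refl
  positionView L (suc zero) _ = second refl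
  positionView L (suc (suc t)) t<L with suc (suc (suc t)) ≟ L
  ... | yes t+1≡L = last t+1≡L
  ... | no t+1≢L = inner (s≤s (s≤s z≤n)) (≤∧≢⇒< t<L t+1≢L)

  -- Non-adjacent attachments u, v give K2,3 (S and the two arcs of h between u and v), or K4 if S
  -- has a further attachment.
  attachments-clique : (h : Hole G) (S : ConnectedSet G) → (∀ x → Mem S x → ¬ x ∈Hole h) →
                       ∀ u v → u ∈Hole h → v ∈Hole h → AttachedTo S u → AttachedTo S v → u ≡ v ⊎ Adj G u v
  attachments-clique h S S∩h u v u∈ v∈ S-u S-v with u ≟F v | adj? u v
  ... | yes u≡v | _ = inj₁ u≡v
  ... | no _ | yes uv = inj₂ uv
  ... | no u≢v | no ¬uv with rootAt h u u∈
  ... | h′ , same , refl = ⊥-elim (at-position (Equivalence.to (same v) v∈))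
    where
    S∩h′ : ∀ x → Mem S x → ¬ x ∈Hole h′
    S∩h′ x x∈S x∈h′ = S∩h x x∈S (Equivalence.from (same x) x∈h′)
    three : (p q : Fin (len h′)) → toℕ p < toℕ q → vtx h′ p ≢ v0 h′ →
            AttachedTo S (vtx h′ p) → AttachedTo S (vtx h′ q) → ⊥
    three p q p<q p≢0 S-p S-q with toℕ p in ep | toℕ q in eq
    ... | zero | _ = p≢0 (vtx≡at h′ p (0<len h′) ep)
    ... | suc _ | zero = ⊥-elim (n≮0 p<q)
    ... | suc t | suc k = ¬K4 (ThreeAttachments.K4≤im h′ S S∩h′ t k p<q k+1<len S-u
                                (subst (AttachedTo S) (vtx≡at h′ p (<-trans p<q k+1<len) ep) S-p)
                                (subst (AttachedTo S) (vtx≡at h′ q k+1<len eq) S-q))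
      where
      k+1<len : suc k < len h′
      k+1<len = subst (_< len h′) eq (toℕ<n q)
    at-position : v ∈Hole h′ → ⊥
    at-position (j , refl) with positionView (len h′) (toℕ j) (toℕ<n j)
    ... | first j≡0 = u≢v (sym (vtx≡at h′ j (0<len h′) j≡0))
    ... | second j≡1 = ¬uv (subst (Adj G (v0 h′)) (sym (vtx≡at h′ j (1<len h′) j≡1)) (adj-v0-v1 h′))
    ... | last j+1≡len = ¬uv (subst (Adj G (v0 h′))
                                (sym (vtx≡at h′ j (len∸1<len h′) (suc-injective (trans j+1≡len (sym (suc[len∸1]≡len h′))))))
                                (adj-sym G (adj-vlast-v0 h′)))
    ... | inner 2≤j j+1<len with any? (λ i → attachedTo? S (vtx h′ i) ×-dec (¬? (vtx h′ i ≟F v0 h′) ×-dec ¬? (vtx h′ i ≟F vtx h′ j)))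
    ...   | no none = ¬K23 (TwoAttachments.K23≤im h′ S S∩h′ (toℕ j) 2≤j j+1<len S-u
                              (subst (AttachedTo S) vj≡ S-v) only-two)
      where
      vj≡ : vtx h′ j ≡ at h′ (toℕ j) _
      vj≡ = at-toℕ h′ j
      only-two : ∀ s y → Mem S s → y ∈Hole h′ → Adj G y s → y ≡ v0 h′ ⊎ y ≡ at h′ (toℕ j) _
      only-two s y s∈S (i , refl) e with vtx h′ i ≟F v0 h′ | vtx h′ i ≟F vtx h′ j
      ... | yes q | _ = inj₁ q
      ... | no _ | yes q = inj₂ (trans q vj≡)
      ... | no q₁ | no q₂ = ⊥-elim (none (i , (s , s∈S , e) , q₁ , q₂))
    ...   | yes (i , S-i , i≢0 , i≢j) with <-cmp (toℕ i) (toℕ j)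
    ...     | tri≈ _ i≡j _ = i≢j (cong (vtx h′) (toℕ-injective i≡j))
    ...     | tri< i<j _ _ = three i j i<j i≢0 S-i S-v
    ...     | tri> _ _ j<i = three j i j<i (λ vj≡v0 → u≢v (sym vj≡v0)) S-v S-i

  no-third-attachment : (h : Hole G) (S : ConnectedSet G) → (∀ x → Mem S x → ¬ x ∈Hole h) →
                        ∀ y u v → y ∈Hole h → u ∈Hole h → v ∈Hole h → AttachedTo S y → AttachedTo S u → AttachedTo S v →
                        Adj G u v → y ≢ u → y ≢ v → ⊥
  no-third-attachment h S S∩h y u v y∈ u∈ v∈ S-y S-u S-v uv y≢u y≢v
    with attachments-clique h S S∩h y u y∈ u∈ S-y S-u | attachments-clique h S S∩h y v y∈ v∈ S-y S-v
  ... | inj₁ y≡u | _ = y≢u y≡u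
  ... | inj₂ _ | inj₁ y≡v = y≢v y≡v
  ... | inj₂ yu | inj₂ yv = triangle-free h u y v u∈ y∈ v∈ (adj-sym G yu) uv yv

  -- Walk along C from a vertex in D to the first vertex outside D.
  edge-leaving : (C D : Hole G) (x y : Fin n) → x ∈Hole C → ¬ x ∈Hole D → y ∈Hole C → y ∈Hole D →
                 Σ (Fin n) λ a → Σ (Fin n) λ q → a ∈Hole C × q ∈Hole C × a ∈Hole D × ¬ q ∈Hole D × Adj G a q
  edge-leaving C D x y x∈C x∉D y∈C y∈D with rootAt C y y∈C
  ... | C′ , same , v0≡y with least-witness Outside outside? (toℕ (proj₁ x∈C′)) x-outside
    where
    Outside : ℕ → Set
    Outside k = Σ (k < len C′) λ k<len → ¬ at C′ k k<len ∈Hole D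
    outside? : ∀ k → Dec (Outside k)
    outside? k with k <? len C′
    ... | no k≮len = no λ (k<len , _) → k≮len k<len
    ... | yes k<len with at C′ k k<len ∈Hole? D
    ...   | yes ∈D = no λ (_ , ∉D) → ∉D ∈D
    ...   | no ∉D = yes (k<len , ∉D)
    x∈C′ = Equivalence.to (same x) x∈C
    x-outside : Outside (toℕ (proj₁ x∈C′))
    x-outside = toℕ<n _ , λ ∈D → x∉D (subst (_∈Hole D) (trans (sym (at-toℕ C′ _)) (proj₂ x∈C′)) ∈D)
  ... | zero , (_ , v0∉D) , _ = ⊥-elim (v0∉D (subst (_∈Hole D) (sym v0≡y) y∈D))
  ... | suc p , (p+1<len , ∉D) , below =
    at C′ p p<len , at C′ (suc p) p+1<len , Equivalence.from (same _) (_ , refl) , Equivalence.from (same _) (_ , refl) ,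
    ∈D , ∉D , adj-suc C′ p p+1<len
    where
    p<len : p < len C′
    p<len = <-trans (n<1+n p) p+1<len
    ∈D : at C′ p p<len ∈Hole D
    ∈D with at C′ p p<len ∈Hole? D
    ... | yes ∈D = ∈D
    ... | no ∉D′ = ⊥-elim (below p (n<1+n p) (p<len , ∉D′))

  -- Leaving D along the edge v0 C – v1 C, the hole C first returns to D at position r + 1 ≥ 2:
  -- the arc between is attached to D at v0 C and at the return vertex only, which forces F1.
  module ReturningArc (C D : Hole G) (a∈D : v0 C ∈Hole D) (r : ℕ) (1≤r : 1 ≤ r) (r+1<len : suc r < len C)
                      (b∈D : at C (suc r) r+1<len ∈Hole D)
                      (arc∉D : ∀ k (k<len : k < len C) → 1 ≤ k → k < suc r → ¬ at C k k<len ∈Hole D) where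

    a b : Fin n
    a = v0 C
    b = at C (suc r) r+1<len

    r<len : r < len C
    r<len = <-trans (n<1+n r) r+1<len

    Q : ConnectedSet G
    Q = segment C 1 (suc r) (s≤s 1≤r) (<⇒≤ r+1<len)

    Q∩D : ∀ x → Mem Q x → ¬ x ∈Hole D
    Q∩D x (j , refl , 1≤j , j<r+1) x∈D = arc∉D (toℕ j) (toℕ<n j) 1≤j j<r+1 (subst (_∈Hole D) (at-toℕ C j) x∈D)

    Q-a : AttachedTo Q a
    Q-a = v1 C , at∈segment C (1<len C) ≤-refl (s≤s 1≤r) , adj-v0-v1 C

    Q-b : AttachedTo Q b
    Q-b = at C r r<len , at∈segment C r<len 1≤r ≤-refl , adjAt C r+1<len r<len (inj₂ (inj₁ refl))

    ab : Adj G a b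
    ab with attachments-clique D Q Q∩D a b a∈D b∈D Q-a Q-b
    ... | inj₁ a≡b = ⊥-elim (index≢0 (s≤s z≤n) ≤-refl (trans (sym (toℕ-fromℕ< r+1<len)) (index-v0 C _ (sym a≡b))))
    ... | inj₂ ab = ab

    r+2≡len : suc (suc r) ≡ len C
    r+2≡len with neighbour-v0-index C (fromℕ< r+1<len) ab
    ... | inj₁ r+1≡1 = ⊥-elim (index≢0 1≤r ≤-refl (suc-injective (trans (sym (toℕ-fromℕ< r+1<len)) r+1≡1)))
    ... | inj₂ r+2≡len = trans (cong suc (sym (toℕ-fromℕ< r+1<len))) r+2≡len

    b≡vlast : b ≡ vlast C
    b≡vlast = vtx≡at C _ (len∸1<len C)
                (trans (toℕ-fromℕ< r+1<len) (suc-injective (trans r+2≡len (sym (suc[len∸1]≡len C)))))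

    2<r+1 : 2 < suc r
    2<r+1 = ≤-pred (subst (4 ≤_) (sym r+2≡len) (len≥4 C))

    U W : ConnectedSet G
    U = segment C 1 2 (s≤s (s≤s z≤n)) (1<len C)
    W = segment C 2 (suc r) 2<r+1 (<⇒≤ r+1<len)

    U⊆Q : ∀ {x} → Mem U x → Mem Q x
    U⊆Q = segment-mono C ≤-refl (<⇒≤ 2<r+1)

    W⊆Q : ∀ {x} → Mem W x → Mem Q x
    W⊆Q = segment-mono C (s≤s z≤n) ≤-refl

    contradiction : ⊥
    contradiction with rootAtEdge D a b a∈D b∈D ab
    ... | D′ , same , v0≡a , vlast≡b = ¬F1 (HoleWithHandle.F1≤im D′ U W U∩D′ W∩D′ U∩W U-W U-v0 W-vlast U-to-D′ W-to-D′)
      where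
      in-D : ∀ {x} → x ∈Hole D′ → x ∈Hole D
      in-D {x} = Equivalence.from (same x)
      U∩D′ : ∀ x → Mem U x → ¬ x ∈Hole D′
      U∩D′ x x∈U x∈D′ = Q∩D x (U⊆Q x∈U) (in-D x∈D′)
      W∩D′ : ∀ x → Mem W x → ¬ x ∈Hole D′
      W∩D′ x x∈W x∈D′ = Q∩D x (W⊆Q x∈W) (in-D x∈D′)
      U∩W : ∀ x → Mem U x → ¬ Mem W x
      U∩W x x∈U x∈W = segments-disjoint C x∈U x∈W ≤-refl refl
      U-W : Touching U W
      U-W = v1 C , at C 2 (2<len C) , at∈segment C (1<len C) ≤-refl ≤-refl ,
            at∈segment C (2<len C) ≤-refl 2<r+1 , adj-suc C 1 (2<len C)
      U-v0 : AttachedTo U (v0 D′)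
      U-v0 = v1 C , at∈segment C (1<len C) ≤-refl ≤-refl , subst (λ t → Adj G t (v1 C)) (sym v0≡a) (adj-v0-v1 C)
      W-vlast : AttachedTo W (vlast D′)
      W-vlast = at C r r<len , at∈segment C r<len (≤-pred 2<r+1) ≤-refl ,
                subst (λ t → Adj G t (at C r r<len)) (sym vlast≡b) (adjAt C r+1<len r<len (inj₂ (inj₁ refl)))
      U-to-D′ : ∀ u i → Mem U u → Adj G u (vtx D′ i) → toℕ i ≡ 0
      U-to-D′ u i u∈U e with vtx D′ i ≟F a | vtx D′ i ≟F b
      ... | yes ≡a | _ = index-v0 D′ i (trans ≡a (sym v0≡a))
      ... | no _ | yes ≡b = ⊥-elim (¬adj-v1-vlast C (subst₂ (Adj G) (segment[1,2]≡v1 C u∈U) (trans ≡b b≡vlast) e))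
      ... | no ≢a | no ≢b = ⊥-elim (no-third-attachment D Q Q∩D (vtx D′ i) a b (in-D (i , refl)) a∈D b∈D
                              (u , U⊆Q u∈U , adj-sym G e) Q-a Q-b ab ≢a ≢b)
      W-to-D′ : ∀ w i → Mem W w → Adj G w (vtx D′ i) → suc (toℕ i) ≡ len D′
      W-to-D′ w i w∈W e with vtx D′ i ≟F b | vtx D′ i ≟F a
      ... | yes ≡b | _ = index-vlast D′ i (trans ≡b (sym vlast≡b))
      ... | no _ | yes ≡a = ⊥-elim (segments-nonadjacent C (at∈segment C (0<len C) z≤n (s≤s z≤n)) w∈W ≤-refl
                                     (inj₂ r+1<len) (adj-sym G (subst (Adj G w) ≡a e)))
      ... | no ≢b | no ≢a = ⊥-elim (no-third-attachment D Q Q∩D (vtx D′ i) a b (in-D (i , refl)) a∈D b∈D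
                              (w , W⊆Q w∈W , adj-sym G e) Q-a Q-b ab ≢a ≢b)

  module SingleSharedVertex (C D : Hole G) (a∈D : v0 C ∈Hole D)
                            (C∩D : ∀ x → x ∈Hole C → x ∈Hole D → x ≡ v0 C) where

    a : Fin n
    a = v0 C

    Q : ConnectedSet G
    Q = segment C 1 (len C) (1<len C) ≤-refl

    Q∩D : ∀ x → Mem Q x → ¬ x ∈Hole D
    Q∩D x x∈Q x∈D = segment≢v0 C x∈Q ≤-refl (C∩D x (segment⊆hole C x∈Q) x∈D)

    Q-a : AttachedTo Q a
    Q-a = v1 C , at∈segment C (1<len C) ≤-refl (1<len C) , adj-v0-v1 C

    -- If Q sees no vertex of D other than a, the two holes form F2 around a.
    only-at-a⇒⊥ : ¬ (Σ (Fin (len D)) λ j → AttachedTo Q (vtx D j) × vtx D j ≢ a) → ⊥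
    only-at-a⇒⊥ none with rootAt D a a∈D
    ... | D′ , same , v0≡a = ¬F2 (TwoHolesJoinedAt.F2≤im C D′ (singleton a) refl v0≡a (λ _ x≡a _ → x≡a)
                                   (λ _ x≡a _ → trans x≡a (sym v0≡a)) C∩D′⊆a a-to-C a-to-D′ C-to-D′)
      where
      in-D : ∀ {x} → x ∈Hole D′ → x ∈Hole D
      in-D {x} = Equivalence.from (same x)
      C∩D′⊆a : ∀ x → x ∈Hole C → x ∈Hole D′ → x ≡ a
      C∩D′⊆a x x∈C x∈D′ = C∩D x x∈C (in-D x∈D′)
      a-to-C : ∀ z (i : Fin (len C)) → z ≡ a → Adj G z (vtx C i) → toℕ i ≡ 0 ⊎ toℕ i ≡ 1 ⊎ suc (toℕ i) ≡ len C
      a-to-C _ i refl e = inj₂ (neighbour-v0-index C i e)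
      a-to-D′ : ∀ z (i : Fin (len D′)) → z ≡ a → Adj G z (vtx D′ i) → toℕ i ≡ 0 ⊎ toℕ i ≡ 1 ⊎ suc (toℕ i) ≡ len D′
      a-to-D′ _ i refl e = inj₂ (neighbour-v0-index D′ i (subst (λ t → Adj G t (vtx D′ i)) (sym v0≡a) e))
      C-to-D′ : ∀ i j → 1 ≤ toℕ i → 1 ≤ toℕ j → ¬ Adj G (vtx C i) (vtx D′ j)
      C-to-D′ i j 1≤i 1≤j e with in-D (j , refl)
      ... | j′ , vj′≡ = none (j′ , subst (AttachedTo Q) (sym vj′≡) (vtx C i , (i , refl , 1≤i , toℕ<n i) , adj-sym G e) ,
                              λ ≡a → index≢0 1≤j ≤-refl (index-v0 D′ j (trans (sym vj′≡) (trans ≡a (sym v0≡a)))))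

    -- Otherwise Q sees some e ≠ a on D, which is adjacent to a and to v1 C or vlast C; this forces F1.
    other-attachment⇒⊥ : (j₀ : Fin (len D)) → AttachedTo Q (vtx D j₀) → vtx D j₀ ≢ a → ⊥
    other-attachment⇒⊥ j₀ Q-e e≢a with rootAtEdge D a e a∈D (j₀ , refl) ae
      where
      e = vtx D j₀
      ae : Adj G a e
      ae with attachments-clique D Q Q∩D a e a∈D (j₀ , refl) Q-a Q-e
      ... | inj₁ a≡e = ⊥-elim (e≢a (sym a≡e))
      ... | inj₂ ae = ae
    ... | D′ , sameD , v0≡a , vlast≡e = via-v1-or-vlast Q-e
      where
      e = vtx D j₀
      ae : Adj G a e
      ae = subst₂ (Adj G) v0≡a vlast≡e (adj-sym G (adj-vlast-v0 D′))
      e∉C : ¬ e ∈Hole C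
      e∉C e∈C = e≢a (C∩D e e∈C (j₀ , refl))
      in-D : ∀ {x} → x ∈Hole D′ → x ∈Hole D
      in-D {x} = Equivalence.from (sameD x)
      linked : (C″ : Hole G) → SameHole C C″ → v0 C″ ≡ a → Adj G e (v1 C″) → ⊥
      linked C″ sameC v0″≡a e-v1 =
        ¬F1 (HolesLinkedAtVertex.F1≤im C″ D′ (trans v0″≡a (sym v0≡a)) C″∩D′ C″-to-D′ vlast-to-C″
                                        (subst (λ t → Adj G t (v1 C″)) (sym vlast≡e) e-v1))
        where
        in-C : ∀ {x} → x ∈Hole C″ → x ∈Hole C
        in-C {x} = Equivalence.from (sameC x)
        C″∩D′ : ∀ x → x ∈Hole C″ → x ∈Hole D′ → x ≡ v0 C″
        C″∩D′ x x∈C″ x∈D′ = trans (C∩D x (in-C x∈C″) (in-D x∈D′)) (sym v0″≡a)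
        C″-to-D′ : ∀ x y → x ∈Hole C″ → x ≢ v0 C″ → y ∈Hole D′ → y ≢ v0 D′ → y ≢ vlast D′ → ¬ Adj G x y
        C″-to-D′ x y x∈C″ x≢v0 y∈D′ y≢v0 y≢vlast xy =
          no-third-attachment D Q Q∩D y a e (in-D y∈D′) a∈D (j₀ , refl)
            (x , ≢v0⇒segment C (in-C x∈C″) (λ x≡a → x≢v0 (trans x≡a (sym v0″≡a))) , adj-sym G xy)
            Q-a Q-e ae (λ y≡a → y≢v0 (trans y≡a (sym v0≡a))) (λ y≡e → y≢vlast (trans y≡e (sym vlast≡e)))
        vlast-to-C″ : ∀ x → x ∈Hole C″ → x ≢ v0 C″ → x ≢ v1 C″ → ¬ Adj G (vlast D′) x
        vlast-to-C″ x x∈C″ x≢v0 x≢v1 ex =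
          no-third-attachment C″ (singleton e) (λ { _ refl e∈C″ → e∉C (in-C e∈C″) }) x (v0 C″) (v1 C″)
            x∈C″ (v0∈ C″) (v1∈ C″)
            (e , refl , adj-sym G (subst (λ t → Adj G t x) vlast≡e ex))
            (e , refl , subst (λ t → Adj G t e) (sym v0″≡a) ae)
            (e , refl , adj-sym G e-v1) (adj-v0-v1 C″) x≢v0 x≢v1
      via-v1-or-vlast : AttachedTo Q e → ⊥
      via-v1-or-vlast (s , s∈Q , es) with attachments-clique C (singleton e) (λ { _ refl e∈C → e∉C e∈C })
                                            a s (v0∈ C) (segment⊆hole C s∈Q) (e , refl , ae) (e , refl , adj-sym G es)
      ... | inj₁ a≡s = segment≢v0 C s∈Q ≤-refl (sym a≡s)
      ... | inj₂ as with neighbour-v0 C s (segment⊆hole C s∈Q) as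
      ...   | inj₁ s≡v1 = linked C (SameHole-refl C) refl (subst (Adj G e) s≡v1 es)
      ...   | inj₂ s≡vlast = linked (reflectHole C) (reflect-same C) (reflect-v0 C)
                               (subst (Adj G e) (trans s≡vlast (sym (reflect-v1 C))) es)

    contradiction : ⊥
    contradiction with any? (λ j → attachedTo? Q (vtx D j) ×-dec ¬? (vtx D j ≟F a))
    ... | no none = only-at-a⇒⊥ none
    ... | yes (j₀ , Q-e , e≢a) = other-attachment⇒⊥ j₀ Q-e e≢a

  -- Root C at an edge leaving D, then follow C until it returns to D (if it does).
  intersecting⇒⊥ : (C D : Hole G) (x y : Fin n) → x ∈Hole C → ¬ x ∈Hole D → y ∈Hole C → y ∈Hole D → ⊥
  intersecting⇒⊥ C D x y x∈C x∉D y∈C y∈D with edge-leaving C D x y x∈C x∉D y∈C y∈D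
  ... | a , q , a∈C , q∈C , a∈D , q∉D , aq with rootAtEdge C a q a∈C q∈C aq
  ... | C₁ , _ , v0≡a , vlast≡q = returns
    where
    C₂ = reflectHole C₁
    v0∈D : v0 C₂ ∈Hole D
    v0∈D = subst (_∈Hole D) (sym (trans (reflect-v0 C₁) v0≡a)) a∈D
    v1∉D : ¬ v1 C₂ ∈Hole D
    v1∉D v1∈D = q∉D (subst (_∈Hole D) (trans (reflect-v1 C₁) vlast≡q) v1∈D)
    Returned : ℕ → Set
    Returned k = Σ (k < len C₂) λ k<len → 1 ≤ k × at C₂ k k<len ∈Hole D
    returned? : ∀ k → Dec (Returned k)
    returned? k with k <? len C₂
    ... | no k≮len = no λ (k<len , _) → k≮len k<len
    ... | yes k<len with 1 ≤? k | at C₂ k k<len ∈Hole? D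
    ...   | yes 1≤k | yes ∈D = yes (k<len , 1≤k , ∈D)
    ...   | no 1≰k | _ = no λ (_ , 1≤k , _) → 1≰k 1≤k
    ...   | _ | no ∉D = no λ (_ , _ , ∈D) → ∉D ∈D
    returns : ⊥
    returns with any? (λ i → (1 ≤? toℕ i) ×-dec (vtx C₂ i ∈Hole? D))
    ... | yes (i , 1≤i , ∈D) with least-witness Returned returned? (toℕ i) (toℕ<n i , 1≤i , subst (_∈Hole D) (at-toℕ C₂ i) ∈D)
    ...   | zero , (_ , () , _) , _
    ...   | suc zero , (_ , _ , v1∈D) , _ = v1∉D v1∈D
    ...   | suc r@(suc _) , (r+1<len , _ , b∈D) , below =
            ReturningArc.contradiction C₂ D v0∈D r (s≤s z≤n) r+1<len b∈D (λ k k<len 1≤k k<r+1 ∈D → below k k<r+1 (k<len , 1≤k , ∈D))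
    returns | no none = SingleSharedVertex.contradiction C₂ D v0∈D C₂∩D
      where
      C₂∩D : ∀ x → x ∈Hole C₂ → x ∈Hole D → x ≡ v0 C₂
      C₂∩D x (j , refl) x∈D with toℕ j in eq
      ... | zero = vtx≡at C₂ j (0<len C₂) eq
      ... | suc _ = ⊥-elim (none (j , subst (1 ≤_) (sym eq) (s≤s z≤n) , x∈D))

  module DisjointHoles (C D : Hole G) (C∩D : ∀ x → x ∈Hole C → ¬ x ∈Hole D) where

    D-off-C : ∀ x → Mem (wholeHole D) x → ¬ x ∈Hole C
    D-off-C x x∈D x∈C = C∩D x x∈C (segment⊆hole D x∈D)

    C-off-D : ∀ x → Mem (wholeHole C) x → ¬ x ∈Hole D
    C-off-D x x∈C = C∩D x (segment⊆hole C x∈C)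

    -- D is a connected set off C (and vice versa), so the attachments of either hole on the other form a clique.
    C-clique : ∀ u v → u ∈Hole C → v ∈Hole C → ∀ y → y ∈Hole D → Adj G u y → ∀ y′ → y′ ∈Hole D → Adj G v y′ →
               u ≡ v ⊎ Adj G u v
    C-clique u v u∈ v∈ y y∈ uy y′ y′∈ vy′ =
      attachments-clique C (wholeHole D) D-off-C u v u∈ v∈ (y , ∈wholeHole D y∈ , uy) (y′ , ∈wholeHole D y′∈ , vy′)

    D-clique : ∀ u v → u ∈Hole D → v ∈Hole D → ∀ y → y ∈Hole C → Adj G u y → ∀ y′ → y′ ∈Hole C → Adj G v y′ →
               u ≡ v ⊎ Adj G u v
    D-clique u v u∈ v∈ y y∈ uy y′ y′∈ vy′ =
      attachments-clique D (wholeHole C) C-off-D u v u∈ v∈ (y , ∈wholeHole C y∈ , uy) (y′ , ∈wholeHole C y′∈ , vy′)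

    -- Every edge between the holes meets c or a: contract the edge ca and get F2.
    edge-cover⇒⊥ : (c a : Fin n) → c ∈Hole C → a ∈Hole D → Adj G c a →
                   (∀ x y → x ∈Hole C → y ∈Hole D → Adj G x y → x ≡ c ⊎ y ≡ a) → ⊥
    edge-cover⇒⊥ c a c∈C a∈D ca cover with rootAt C c c∈C | rootAt D a a∈D
    ... | C′ , sameC , v0C≡c | D′ , sameD , v0D≡a =
      ¬F2 (TwoHolesJoinedAt.F2≤im C′ D′ Z (inj₁ v0C≡c) (inj₂ v0D≡a) Z∩C′ Z∩D′ (λ x x∈C′ x∈D′ → ⊥-elim (C∩D x (in-C x∈C′) (in-D x∈D′)))
                                     Z-to-C′ Z-to-D′ C′-to-D′)
      where
      Z = union (singleton c) (singleton a) c a refl refl (inj₂ ca)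
      in-C : ∀ {x} → x ∈Hole C′ → x ∈Hole C
      in-C {x} = Equivalence.from (sameC x)
      in-D : ∀ {x} → x ∈Hole D′ → x ∈Hole D
      in-D {x} = Equivalence.from (sameD x)
      Z∩C′ : ∀ x → Mem Z x → x ∈Hole C′ → x ≡ v0 C′
      Z∩C′ x (inj₁ x≡c) _ = trans x≡c (sym v0C≡c)
      Z∩C′ x (inj₂ refl) x∈C′ = ⊥-elim (C∩D x (in-C x∈C′) a∈D)
      Z∩D′ : ∀ x → Mem Z x → x ∈Hole D′ → x ≡ v0 D′
      Z∩D′ x (inj₂ x≡a) _ = trans x≡a (sym v0D≡a)
      Z∩D′ x (inj₁ refl) x∈D′ = ⊥-elim (C∩D x c∈C (in-D x∈D′))
      Z-to-C′ : ∀ z (i : Fin (len C′)) → Mem Z z → Adj G z (vtx C′ i) → toℕ i ≡ 0 ⊎ toℕ i ≡ 1 ⊎ suc (toℕ i) ≡ len C′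
      Z-to-C′ z i (inj₁ refl) e = inj₂ (neighbour-v0-index C′ i (subst (λ t → Adj G t (vtx C′ i)) (sym v0C≡c) e))
      Z-to-C′ z i (inj₂ refl) e with C-clique (vtx C′ i) c (in-C (i , refl)) c∈C z a∈D (adj-sym G e) z a∈D ca
      ... | inj₁ ≡c = inj₁ (index-v0 C′ i (trans ≡c (sym v0C≡c)))
      ... | inj₂ e′ = inj₂ (neighbour-v0-index C′ i (subst (λ t → Adj G t (vtx C′ i)) (sym v0C≡c) (adj-sym G e′)))
      Z-to-D′ : ∀ z (i : Fin (len D′)) → Mem Z z → Adj G z (vtx D′ i) → toℕ i ≡ 0 ⊎ toℕ i ≡ 1 ⊎ suc (toℕ i) ≡ len D′
      Z-to-D′ z i (inj₂ refl) e = inj₂ (neighbour-v0-index D′ i (subst (λ t → Adj G t (vtx D′ i)) (sym v0D≡a) e))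
      Z-to-D′ z i (inj₁ refl) e with D-clique (vtx D′ i) a (in-D (i , refl)) a∈D z c∈C (adj-sym G e) z c∈C (adj-sym G ca)
      ... | inj₁ ≡a = inj₁ (index-v0 D′ i (trans ≡a (sym v0D≡a)))
      ... | inj₂ e′ = inj₂ (neighbour-v0-index D′ i (subst (λ t → Adj G t (vtx D′ i)) (sym v0D≡a) (adj-sym G e′)))
      C′-to-D′ : ∀ i j → 1 ≤ toℕ i → 1 ≤ toℕ j → ¬ Adj G (vtx C′ i) (vtx D′ j)
      C′-to-D′ i j 1≤i 1≤j e with cover _ _ (in-C (i , refl)) (in-D (j , refl)) e
      ... | inj₁ ≡c = index≢0 1≤i ≤-refl (index-v0 C′ i (trans ≡c (sym v0C≡c)))
      ... | inj₂ ≡a = index≢0 1≤j ≤-refl (index-v0 D′ j (trans ≡a (sym v0D≡a)))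

    -- By the clique property the edges between C and D lie within two edges c c₁ of C and a a₁ of D;
    -- according to the cross edges among c, c₁, a, a₁ this gives K4, F2 or F1.
    joined⇒⊥ : (c a : Fin n) → c ∈Hole C → a ∈Hole D → Adj G c a → ⊥
    joined⇒⊥ c a c∈C a∈D ca
      with any? (λ i → any? (λ j → adj? (vtx C i) (vtx D j) ×-dec (¬? (vtx C i ≟F c) ×-dec ¬? (vtx D j ≟F a))))
    ... | no none = edge-cover⇒⊥ c a c∈C a∈D ca cover
      where
      cover : ∀ x y → x ∈Hole C → y ∈Hole D → Adj G x y → x ≡ c ⊎ y ≡ a
      cover x y (i , refl) (j , refl) e with vtx C i ≟F c | vtx D j ≟F a
      ... | yes ≡c | _ = inj₁ ≡c
      ... | no _ | yes ≡a = inj₂ ≡a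
      ... | no ≢c | no ≢a = ⊥-elim (none (i , j , e , ≢c , ≢a))
    ... | yes (i , j , c₁a₁ , c₁≢c , a₁≢a) = by-cross-edges
      where
      c₁ = vtx C i
      a₁ = vtx D j
      c₁∈C : c₁ ∈Hole C
      c₁∈C = i , refl
      a₁∈D : a₁ ∈Hole D
      a₁∈D = j , refl
      cc₁ : Adj G c c₁
      cc₁ with C-clique c c₁ c∈C c₁∈C a a∈D ca a₁ a₁∈D c₁a₁
      ... | inj₁ c≡c₁ = ⊥-elim (c₁≢c (sym c≡c₁))
      ... | inj₂ cc₁ = cc₁
      aa₁ : Adj G a a₁
      aa₁ with D-clique a a₁ a∈D a₁∈D c c∈C (adj-sym G ca) c₁ c₁∈C (adj-sym G c₁a₁)
      ... | inj₁ a≡a₁ = ⊥-elim (a₁≢a (sym a≡a₁))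
      ... | inj₂ aa₁ = aa₁
      on-C : ∀ x y → x ∈Hole C → y ∈Hole D → Adj G x y → x ≡ c ⊎ x ≡ c₁
      on-C x y x∈C y∈D xy with x ≟F c | x ≟F c₁
      ... | yes ≡c | _ = inj₁ ≡c
      ... | no _ | yes ≡c₁ = inj₂ ≡c₁
      ... | no ≢c | no ≢c₁ with C-clique x c x∈C c∈C y y∈D xy a a∈D ca | C-clique x c₁ x∈C c₁∈C y y∈D xy a₁ a₁∈D c₁a₁
      ...   | inj₁ ≡c | _ = ⊥-elim (≢c ≡c)
      ...   | inj₂ _ | inj₁ ≡c₁ = ⊥-elim (≢c₁ ≡c₁)
      ...   | inj₂ xc | inj₂ xc₁ = ⊥-elim (triangle-free C c x c₁ c∈C x∈C c₁∈C (adj-sym G xc) cc₁ xc₁)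
      on-D : ∀ x y → x ∈Hole C → y ∈Hole D → Adj G x y → y ≡ a ⊎ y ≡ a₁
      on-D x y x∈C y∈D xy with y ≟F a | y ≟F a₁
      ... | yes ≡a | _ = inj₁ ≡a
      ... | no _ | yes ≡a₁ = inj₂ ≡a₁
      ... | no ≢a | no ≢a₁ with D-clique y a y∈D a∈D x x∈C (adj-sym G xy) c c∈C (adj-sym G ca)
                              | D-clique y a₁ y∈D a₁∈D x x∈C (adj-sym G xy) c₁ c₁∈C (adj-sym G c₁a₁)
      ...   | inj₁ ≡a | _ = ⊥-elim (≢a ≡a)
      ...   | inj₂ _ | inj₁ ≡a₁ = ⊥-elim (≢a₁ ≡a₁)
      ...   | inj₂ ya | inj₂ ya₁ = ⊥-elim (triangle-free D a y a₁ a∈D y∈D a₁∈D (adj-sym G ya) aa₁ ya₁)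
      by-cross-edges : ⊥
      by-cross-edges with adj? c a₁ | adj? c₁ a
      ... | yes ca₁ | yes c₁a = ¬K4 (clique⇒K4 c c₁ a a₁ cc₁ ca ca₁ c₁a c₁a₁ aa₁)
      ... | yes ca₁ | no ¬c₁a = edge-cover⇒⊥ c a₁ c∈C a₁∈D ca₁ cover
        where
        cover : ∀ x y → x ∈Hole C → y ∈Hole D → Adj G x y → x ≡ c ⊎ y ≡ a₁
        cover x y x∈C y∈D xy with on-C x y x∈C y∈D xy
        ... | inj₁ ≡c = inj₁ ≡c
        ... | inj₂ refl with on-D x y x∈C y∈D xy
        ...   | inj₂ ≡a₁ = inj₂ ≡a₁
        ...   | inj₁ refl = ⊥-elim (¬c₁a xy)
      ... | no ¬ca₁ | yes c₁a = edge-cover⇒⊥ c₁ a c₁∈C a∈D c₁a cover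
        where
        cover : ∀ x y → x ∈Hole C → y ∈Hole D → Adj G x y → x ≡ c₁ ⊎ y ≡ a
        cover x y x∈C y∈D xy with on-C x y x∈C y∈D xy
        ... | inj₂ ≡c₁ = inj₁ ≡c₁
        ... | inj₁ refl with on-D x y x∈C y∈D xy
        ...   | inj₁ ≡a = inj₂ ≡a
        ...   | inj₂ refl = ⊥-elim (¬ca₁ xy)
      ... | no ¬ca₁ | no ¬c₁a with rootAtEdge C c c₁ c∈C c₁∈C cc₁
      ...   | C′ , same , v0≡c , vlast≡c₁ =
              ¬F1 (HoleWithHandle.F1≤im C′ (singleton a) (singleton a₁) (λ { _ refl a∈C′ → C∩D a (in-C a∈C′) a∈D })
                     (λ { _ refl a₁∈C′ → C∩D a₁ (in-C a₁∈C′) a₁∈D }) (λ { _ refl a≡a₁ → a₁≢a (sym a≡a₁) })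
                     (a , a₁ , refl , refl , aa₁) (a , refl , subst (λ t → Adj G t a) (sym v0≡c) ca)
                     (a₁ , refl , subst (λ t → Adj G t a₁) (sym vlast≡c₁) c₁a₁) a-to-C′ a₁-to-C′)
        where
        in-C : ∀ {x} → x ∈Hole C′ → x ∈Hole C
        in-C {x} = Equivalence.from (same x)
        a-to-C′ : ∀ u i → u ≡ a → Adj G u (vtx C′ i) → toℕ i ≡ 0
        a-to-C′ _ i refl e with on-C (vtx C′ i) a (in-C (i , refl)) a∈D (adj-sym G e)
        ... | inj₁ ≡c = index-v0 C′ i (trans ≡c (sym v0≡c))
        ... | inj₂ ≡c₁ = ⊥-elim (¬c₁a (subst (λ t → Adj G t a) ≡c₁ (adj-sym G e)))
        a₁-to-C′ : ∀ w i → w ≡ a₁ → Adj G w (vtx C′ i) → suc (toℕ i) ≡ len C′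
        a₁-to-C′ _ i refl e with on-C (vtx C′ i) a₁ (in-C (i , refl)) a₁∈D (adj-sym G e)
        ... | inj₂ ≡c₁ = index-vlast C′ i (trans ≡c₁ (sym vlast≡c₁))
        ... | inj₁ ≡c = ⊥-elim (¬ca₁ (subst (λ t → Adj G t a₁) ≡c (adj-sym G e)))

    -- With no edge between the holes, contract a direct walk c w … a between them: F2 around the walk.
    -- The walk minus a (resp. minus c) is a connected set off D (resp. C), whose attachments on D
    -- (resp. C) therefore form a clique through a (resp. c).
    direct-walk⇒⊥ : (∀ x y → x ∈Hole C → y ∈Hole D → ¬ Adj G x y) → DirectWalk (_∈Hole C) (_∈Hole D) → ⊥
    direct-walk⇒⊥ no-edge (c , a , [] , c∈C , a∈D , [ ca ] , _) = no-edge c a c∈C a∈D ca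
    direct-walk⇒⊥ no-edge (c , a , w ∷ ws , c∈C , a∈D , walk@(cw ∷ rest) , w-out ∷ ws-out)
      with rootAt C c c∈C | rootAt D a a∈D
    ... | C′ , sameC , v0C≡c | D′ , sameD , v0D≡a =
      ¬F2 (TwoHolesJoinedAt.F2≤im C′ D′ Z (subst (Mem Z) (sym v0C≡c) (walkSet-start walk))
                                     (subst (Mem Z) (sym v0D≡a) (walkSet-end walk)) Z∩C′ Z∩D′
                                     (λ x x∈C′ x∈D′ → ⊥-elim (C∩D x (in-C x∈C′) (in-D x∈D′))) Z-to-C′ Z-to-D′
                                     (λ i j _ _ → no-edge _ _ (in-C (i , refl)) (in-D (j , refl))))
      where
      Z = walkSet walk
      in-C : ∀ {x} → x ∈Hole C′ → x ∈Hole C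
      in-C {x} = Equivalence.from (sameC x)
      in-D : ∀ {x} → x ∈Hole D′ → x ∈Hole D
      in-D {x} = Equivalence.from (sameD x)
      outside : ∀ {v} → v ∈ (w ∷ ws) → ¬ v ∈Hole C × ¬ v ∈Hole D
      outside v∈ = All.lookup (w-out ∷ ws-out) v∈
      S₁ = union (walkSet rest) (wholeHole D) a a (walkSet-end rest) (∈wholeHole D a∈D) (inj₁ refl)
      S₁∩C′ : ∀ x → Mem S₁ x → ¬ x ∈Hole C′
      S₁∩C′ x (inj₁ x∈) x∈C′ with walkSet-members rest x∈
      ... | inj₁ refl = proj₁ w-out (in-C x∈C′)
      ... | inj₂ (inj₁ x∈ws) = proj₁ (All.lookup ws-out x∈ws) (in-C x∈C′)
      ... | inj₂ (inj₂ refl) = C∩D x (in-C x∈C′) a∈D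
      S₁∩C′ x (inj₂ x∈D) x∈C′ = C∩D x (in-C x∈C′) (segment⊆hole D x∈D)
      S₂ = union (wholeHole C) (walkSetButLast walk) c c (∈wholeHole C c∈C) (walkSetButLast-start walk) (inj₁ refl)
      S₂∩D′ : ∀ x → Mem S₂ x → ¬ x ∈Hole D′
      S₂∩D′ x (inj₁ x∈C) x∈D′ = C∩D x (segment⊆hole C x∈C) (in-D x∈D′)
      S₂∩D′ x (inj₂ x∈) x∈D′ with walkSetButLast-members walk x∈
      ... | inj₁ refl = C∩D x c∈C (in-D x∈D′)
      ... | inj₂ x∈ws = proj₂ (outside x∈ws) (in-D x∈D′)
      S₁-v0 : AttachedTo S₁ (v0 C′)
      S₁-v0 = w , inj₁ (walkSet-start rest) , subst (λ t → Adj G t w) (sym v0C≡c) cw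
      S₂-v0 : AttachedTo S₂ (v0 D′)
      S₂-v0 with walkSetButLast-last walk
      ... | z , z∈ , az = z , inj₂ z∈ , subst (λ t → Adj G t z) (sym v0D≡a) az
      Z∩C′ : ∀ x → Mem Z x → x ∈Hole C′ → x ≡ v0 C′
      Z∩C′ x x∈Z x∈C′ with walkSet-members walk x∈Z
      ... | inj₁ x≡c = trans x≡c (sym v0C≡c)
      ... | inj₂ (inj₁ x∈ws) = ⊥-elim (proj₁ (outside x∈ws) (in-C x∈C′))
      ... | inj₂ (inj₂ refl) = ⊥-elim (C∩D x (in-C x∈C′) a∈D)
      Z∩D′ : ∀ x → Mem Z x → x ∈Hole D′ → x ≡ v0 D′
      Z∩D′ x x∈Z x∈D′ with walkSet-members walk x∈Z
      ... | inj₂ (inj₂ x≡a) = trans x≡a (sym v0D≡a)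
      ... | inj₂ (inj₁ x∈ws) = ⊥-elim (proj₂ (outside x∈ws) (in-D x∈D′))
      ... | inj₁ refl = ⊥-elim (C∩D x c∈C (in-D x∈D′))
      via-S₁ : ∀ (i : Fin (len C′)) → AttachedTo S₁ (vtx C′ i) → toℕ i ≡ 0 ⊎ toℕ i ≡ 1 ⊎ suc (toℕ i) ≡ len C′
      via-S₁ i S₁-i with attachments-clique C′ S₁ S₁∩C′ (vtx C′ i) (v0 C′) (i , refl) (v0∈ C′) S₁-i S₁-v0
      ... | inj₁ ≡v0 = inj₁ (index-v0 C′ i ≡v0)
      ... | inj₂ e = inj₂ (neighbour-v0-index C′ i (adj-sym G e))
      via-S₂ : ∀ (i : Fin (len D′)) → AttachedTo S₂ (vtx D′ i) → toℕ i ≡ 0 ⊎ toℕ i ≡ 1 ⊎ suc (toℕ i) ≡ len D′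
      via-S₂ i S₂-i with attachments-clique D′ S₂ S₂∩D′ (vtx D′ i) (v0 D′) (i , refl) (v0∈ D′) S₂-i S₂-v0
      ... | inj₁ ≡v0 = inj₁ (index-v0 D′ i ≡v0)
      ... | inj₂ e = inj₂ (neighbour-v0-index D′ i (adj-sym G e))
      Z-to-C′ : ∀ z (i : Fin (len C′)) → Mem Z z → Adj G z (vtx C′ i) → toℕ i ≡ 0 ⊎ toℕ i ≡ 1 ⊎ suc (toℕ i) ≡ len C′
      Z-to-C′ z i z∈Z e with walkSet-members walk z∈Z
      ... | inj₁ refl = inj₂ (neighbour-v0-index C′ i (subst (λ t → Adj G t (vtx C′ i)) (sym v0C≡c) e))
      ... | inj₂ (inj₁ (here refl)) = via-S₁ i (z , inj₁ (walkSet-start rest) , adj-sym G e)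
      ... | inj₂ (inj₁ (there z∈ws)) = via-S₁ i (z , inj₁ (walkSet-inner rest z∈ws) , adj-sym G e)
      ... | inj₂ (inj₂ refl) = via-S₁ i (z , inj₁ (walkSet-end rest) , adj-sym G e)
      Z-to-D′ : ∀ z (i : Fin (len D′)) → Mem Z z → Adj G z (vtx D′ i) → toℕ i ≡ 0 ⊎ toℕ i ≡ 1 ⊎ suc (toℕ i) ≡ len D′
      Z-to-D′ z i z∈Z e with walkSet-members walk z∈Z
      ... | inj₂ (inj₂ refl) = inj₂ (neighbour-v0-index D′ i (subst (λ t → Adj G t (vtx D′ i)) (sym v0D≡a) e))
      ... | inj₁ refl = via-S₂ i (z , inj₂ (walkSetButLast-start walk) , adj-sym G e)
      ... | inj₂ (inj₁ z∈ws) = via-S₂ i (z , inj₂ (walkSetButLast-inner walk z∈ws) , adj-sym G e)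

  exclusive-vertex⇒⊥ : Connected G → (C D : Hole G) (x : Fin n) → x ∈Hole C → ¬ x ∈Hole D → ⊥
  exclusive-vertex⇒⊥ connected C D x x∈C x∉D with any? (λ i → vtx C i ∈Hole? D)
  ... | yes (i , ∈D) = intersecting⇒⊥ C D x (vtx C i) x∈C x∉D (i , refl) ∈D
  ... | no disjoint with any? (λ i → any? (λ j → adj? (vtx C i) (vtx D j)))
  ...   | yes (i , j , e) = DisjointHoles.joined⇒⊥ C D C∩D (vtx C i) (vtx D j) (i , refl) (j , refl) e
    where
    C∩D : ∀ x → x ∈Hole C → ¬ x ∈Hole D
    C∩D x (i , refl) ∈D = disjoint (i , ∈D)
  ...   | no no-edge = DisjointHoles.direct-walk⇒⊥ C D C∩D no-edge′
                         (ShortenWalk.direct (_∈Hole C) (_∈Hole D) (_∈Hole? C) (_∈Hole? D) C∩D (v0∈ C) (v0∈ D)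
                                            (connected (v0 C) (v0 D)))
    where
    C∩D : ∀ x → x ∈Hole C → ¬ x ∈Hole D
    C∩D x (i , refl) ∈D = disjoint (i , ∈D)
    no-edge′ : ∀ x y → x ∈Hole C → y ∈Hole D → ¬ Adj G x y
    no-edge′ x y (i , refl) (j , refl) e = no-edge (i , j , e)

¬¬-∀Fin : ∀ k {Q : Fin k → Set} → (∀ i → ¬ ¬ Q i) → ¬ ¬ (∀ i → Q i)
¬¬-∀Fin zero _ ¬∀ = ¬∀ λ ()
¬¬-∀Fin (suc k) ¬¬Q ¬∀ = ¬¬Q zero λ Q₀ → ¬¬-∀Fin k (¬¬Q ∘ suc) λ Qₛ → ¬∀ λ { zero → Q₀ ; (suc i) → Qₛ i }

-- Adjacency need not be decidable, but membership in a hole is, so the argument may run under a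
-- double negation in which adjacency is decided.
lemma19 : {n : ℕ} (G : Graph n) → Connected G →
          ¬ (K4 ≤im G) → ¬ (K23 ≤im G) → ¬ (F1 ≤im G) → ¬ (F2 ≤im G) →
          (h₁ h₂ : Hole G) → SameHole h₁ h₂
lemma19 {n} G connected ¬K4 ¬K23 ¬F1 ¬F2 h₁ h₂ x = mk⇔ (included h₁ h₂) (included h₂ h₁)
  where
  ¬¬adj? : ¬ ¬ (∀ x y → Dec (Adj G x y))
  ¬¬adj? = ¬¬-∀Fin n λ x → ¬¬-∀Fin n λ y → ¬¬-excluded-middle
  included : (C D : Hole G) → x ∈Hole C → x ∈Hole D
  included C D x∈C with x ∈Hole? D
  ... | yes x∈D = x∈D
  ... | no x∉D = ⊥-elim (¬¬adj? λ adj? → InducedMinorFree.exclusive-vertex⇒⊥ G adj? ¬K4 ¬K23 ¬F1 ¬F2 connected C D x x∈C x∉D)
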